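{- Let $G$ be a finite tree, or a finite complete graph, or a hypercube graph $Q_d$ ($d\ge 0$). Then $\mathcal{H}^{\mathrm{Cube}}_n(G)\cong\mathcal{H}^{\mathrm{Path}}_n(G)\cong(0)$ for all $n>0$.
   Context: $R$ is a commutative ring with unit; graphs are finite, simple and undirected. A graph homomorphism $\sigma: G\to H$ is a vertex map sending adjacent vertices to equal or adjacent vertices. $Q_d$ is the graph on $\{0,1\}^d$ with edges between vertices at Hamming distance one ($Q_0$ is a single vertex). Discrete cubical homology $\mathcal{H}^{\mathrm{Cube}}_\bullet(G)$: a singular $n$-cube is a graph homomorphism $\sigma: Q_n\to G$; $\mathcal{L}^{\mathrm{Cube}}_n(G)$ is the free $R$-module on them. For $n\ge1$, $i\in[n]$: $f_i^{\pm}\sigma(a_1,\dots,a_{n-1})=\sigma(a_1,\dots,a_{i-1},\epsilon,a_i,\dots,a_{n-1})$ with $\epsilon=1$ for $+$ and $\epsilon=0$ for $-$. $\sigma$ is degenerate if $f_i^+\sigma=f_i^-\sigma$ for some $i$ ($0$-cubes are non-degenerate). $\mathcal{C}^{\mathrm{Cube}}_n(G)$ is $\mathcal{L}^{\mathrm{Cube}}_n(G)$ modulo the span of degenerate cubes, with boundary $\partial_n\sigma=\sum_{i=1}^n(-1)^i(f_i^-\sigma-f_i^+\sigma)$, $\partial_0=0$; $\mathcal{H}^{\mathrm{Cube}}_n(G)$ is its $n$-th homology. Path homology $\mathcal{H}^{\mathrm{Path}}_\bullet(G)$: for $V=V(G)$, $\mathcal{C}_n(V)$ is the free $R$-module on $(n+1)$-tuples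 of elements of $V$ modulo the span of tuples with $v_i=v_{i+1}$ for some $i$, with $\partial_n(v_0,\dots,v_n)=\sum_{i=0}^n(-1)^i(v_0,\dots,\widehat{v_i},\dots,v_n)$, $\partial_0=0$. An allowed path is a tuple with $\{v_i,v_{i+1}\}\in E(G)$ for all $i$; $\widetilde{\mathcal{C}}_n(G)$ is the submodule of $\mathcal{C}_n(V)$ generated by allowed paths ($\widetilde{\mathcal{C}}_{ -1}=0$); $\mathcal{C}^{\mathrm{Path}}_n(G)=\{x\in\widetilde{\mathcal{C}}_n(G):\partial_n x\in\widetilde{\mathcal{C}}_{n-1}(G)\}$, and $\mathcal{H}^{\mathrm{Path}}_n(G)$ is the homology of this chain complex. -}

module Defs where

open import Level using (_⊔_)
open import Data.Bool using (Bool; true; false; if_then_else_)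
open import Data.Nat using (ℕ; zero; suc)
open import Data.Fin using (Fin; zero; suc; inject₁; fromℕ; toℕ)
open import Data.Vec using (Vec; []; _∷_; insertAt; removeAt)
open import Data.Vec.Properties using (≡-dec)
open import Data.List using (List; []; _∷_; _++_; map; concatMap; allFin)
open import Data.List.Membership.Propositional using (_∈_)
open import Data.List.Membership.Propositional.Properties using (∈-allFin; ∈-++⁺ˡ; ∈-++⁺ʳ; ∈-map⁺)
open import Data.List.Relation.Unary.All using (All)
open import Data.List.Relation.Unary.Any using (here)
open import Data.Product using (Σ; Σ-syntax; ∃; ∃-syntax; _×_; _,_; proj₁; proj₂)
open import Data.Sum using (_⊎_; inj₁; inj₂)
open import Data.Empty using (⊥)
open import Data.Unit using (⊤)
import Level
open import Relation.Nullary using (¬_; Dec; yes; no; does)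
open import Relation.Binary.PropositionalEquality using (_≡_; _≢_; refl; sym)
open import Relation.Binary.Definitions using (DecidableEquality)
open import Algebra.Bundles using (CommutativeRing)
import Data.Bool as B

record Graph : Set₁ where
  field
    V        : Set
    _≟V_     : DecidableEquality V
    vertices : List V                       -- finiteness: an enumeration
    complete : ∀ v → v ∈ vertices
    Adj      : V → V → Set
    Adj-sym  : ∀ {u v} → Adj u v → Adj v u
    Adj-irr  : ∀ {v} → ¬ Adj v v

open Graph public

data Walk (G : Graph) : V G → V G → Set where
  stop : ∀ v → Walk G v v
  step : ∀ {u w v} → Adj G u w → Walk G w v → Walk G u v

Connected : Graph → Set
Connected G = ∀ u v → Walk G u v

-- a cycle v_0 v_1 ... v_{m-1} v_0 with m = len + 3 ≥ 3 distinct vertices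
record Cycle (G : Graph) : Set where
  field
    len   : ℕ
    vs    : Fin (suc (suc (suc len))) → V G
    inj   : ∀ i j → vs i ≡ vs j → i ≡ j
    adj   : ∀ (i : Fin (suc (suc len))) → Adj G (vs (inject₁ i)) (vs (suc i))
    close : Adj G (vs (fromℕ (suc (suc len)))) (vs zero)

Acyclic : Graph → Set
Acyclic G = Cycle G → ⊥

IsTree : Graph → Set
IsTree G = Connected G × Acyclic G

IsComplete : Graph → Set
IsComplete G = ∀ u v → u ≢ v → Adj G u v

data QAdj : ∀ {n} → Vec Bool n → Vec Bool n → Set where
  here  : ∀ {n b c} {as : Vec Bool n} → b ≢ c → QAdj (b ∷ as) (c ∷ as)
  there : ∀ {n b} {as bs : Vec Bool n} → QAdj as bs → QAdj (b ∷ as) (b ∷ bs)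

QAdj-sym : ∀ {n} {a b : Vec Bool n} → QAdj a b → QAdj b a
QAdj-sym (here ne) = here (λ e → ne (sym e))
QAdj-sym (there p) = there (QAdj-sym p)

QAdj-irr : ∀ {n} {a : Vec Bool n} → ¬ QAdj a a
QAdj-irr (here ne) = ne refl
QAdj-irr (there p) = QAdj-irr p

allVec : ∀ n → List (Vec Bool n)
allVec zero    = [] ∷ []
allVec (suc n) = map (false ∷_) (allVec n) ++ map (true ∷_) (allVec n)

allVec-complete : ∀ {n} (a : Vec Bool n) → a ∈ allVec n
allVec-complete [] = here refl
allVec-complete {suc n} (false ∷ a) = ∈-++⁺ˡ (∈-map⁺ (false ∷_) (allVec-complete a))
allVec-complete {suc n} (true ∷ a)  = ∈-++⁺ʳ (map (false ∷_) (allVec n)) (∈-map⁺ (true ∷_) (allVec-complete a))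

Q : ℕ → Graph
Q d = record
  { V = Vec Bool d ; _≟V_ = ≡-dec B._≟_ ; vertices = allVec d
  ; complete = allVec-complete ; Adj = QAdj ; Adj-sym = QAdj-sym ; Adj-irr = QAdj-irr }

insertAt-QAdj : ∀ {n} {a b : Vec Bool n} (i : Fin (suc n)) (e : Bool) →
                QAdj a b → QAdj (insertAt a i e) (insertAt b i e)
insertAt-QAdj zero    e p         = there p
insertAt-QAdj (suc i) e (here ne) = here ne
insertAt-QAdj (suc i) e (there p) = there (insertAt-QAdj i e p)

∀Vec? : ∀ n {P : Vec Bool n → Set} → (∀ a → Dec (P a)) → Dec (∀ a → P a)
∀Vec? zero    d with d []
... | yes p = yes λ { [] → p }
... | no ¬p = no λ f → ¬p (f [])
∀Vec? (suc n) {P} d with ∀Vec? n (λ a → d (false ∷ a)) | ∀Vec? n (λ a → d (true ∷ a))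
... | yes f | yes t = yes λ { (false ∷ a) → f a ; (true ∷ a) → t a }
... | no ¬f | _     = no λ g → ¬f (λ a → g (false ∷ a))
... | yes _ | no ¬t = no λ g → ¬t (λ a → g (true ∷ a))

module Chains {c ℓ} (R : CommutativeRing c ℓ) where
  open CommutativeRing R using (Carrier; _≈_; _+_; -_; 0#)

  -- elements of the free R-module on X, as finite formal combinations
  Comb : Set → Set c
  Comb X = List (Carrier × X)

  coeff : {X : Set} → (X → X → Bool) → Comb X → X → Carrier
  coeff eq []            g = 0#
  coeff eq ((r , x) ∷ xs) g = (if eq x g then r else 0#) + coeff eq xs g

  -- x ≈ y in (free module on X) / span{ generators satisfying D }:
  -- x - y is (coefficientwise) a combination z of generators in D
  EqMod : {X : Set} → (X → X → Bool) → (X → Set) → Comb X → Comb X → Set (c ⊔ ℓ)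
  EqMod eq D x y = Σ[ z ∈ Comb _ ] (All (λ p → D (proj₂ p)) z
                    × (∀ g → coeff eq x g ≈ coeff eq y g + coeff eq z g))

  sgn : ℕ → Carrier → Carrier
  sgn zero    r = r
  sgn (suc i) r = - sgn i r

  module _ (G : Graph) where

    -- singular n-cube: graph homomorphism Q_n → G
    Cube : ℕ → Set
    Cube n = Σ[ σ ∈ (Vec Bool n → V G) ]
               (∀ {a b} → QAdj a b → σ a ≡ σ b ⊎ Adj G (σ a) (σ b))

    cubeEq : ∀ {n} → Cube n → Cube n → Bool
    cubeEq {n} (σ , _) (τ , _) = does (∀Vec? n (λ a → _≟V_ G (σ a) (τ a)))

    -- face f_{i+1}^ε (i is 0-based)
    face : ∀ {n} → Fin (suc n) → Bool → Cube (suc n) → Cube n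
    face i e (σ , h) = (λ a → σ (insertAt a i e)) , (λ p → h (insertAt-QAdj i e p))

    Degenerate : ∀ {n} → Cube n → Set
    Degenerate {zero}  _ = ⊥
    Degenerate {suc n} σ = Σ[ i ∈ Fin (suc n) ]
      (∀ a → proj₁ (face i true σ) a ≡ proj₁ (face i false σ) a)

    CubeChain : ℕ → Set c
    CubeChain n = Comb (Cube n)

    -- equality in C^Cube_n(G) = L^Cube_n(G) / degenerate cubes
    _≈Cube_ : ∀ {n} → CubeChain n → CubeChain n → Set (c ⊔ ℓ)
    _≈Cube_ = EqMod cubeEq Degenerate

    -- ∂σ = Σ_{i=1}^{n} (-1)^i (f_i^- σ - f_i^+ σ)
    ∂Cube : ∀ {n} → CubeChain (suc n) → CubeChain n
    ∂Cube {n} = concatMap λ { (r , σ) → concatMap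
      (λ i → (sgn (suc (toℕ i)) r , face i false σ)
           ∷ (- sgn (suc (toℕ i)) r , face i true σ) ∷ [])
      (allFin (suc n)) }

    -- H^Cube_n(G) ≅ 0 : every n-cycle is an n-boundary
    -- (stated for positive degree suc n only)
    CubeHomologyVanishesAt : ℕ → Set (c ⊔ ℓ)
    CubeHomologyVanishesAt zero    = Level.Lift _ ⊤
    CubeHomologyVanishesAt (suc n) =
      ∀ (x : CubeChain (suc n)) → ∂Cube x ≈Cube [] →
        Σ[ y ∈ CubeChain (suc (suc n)) ] (∂Cube y ≈Cube x)

    -- Path chains; a generator of C_n(V) is an (n+1)-tuple

    Tuple : ℕ → Set
    Tuple n = Vec (V G) (suc n)

    tupleEq : ∀ {n} → Tuple n → Tuple n → Bool
    tupleEq u v = does (≡-dec (_≟V_ G) u v)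

    data HasRepeat : ∀ {m} → Vec (V G) m → Set where
      rep  : ∀ {m x y} {xs : Vec (V G) m} → x ≡ y → HasRepeat (x ∷ y ∷ xs)
      skip : ∀ {m x} {xs : Vec (V G) m} → HasRepeat xs → HasRepeat (x ∷ xs)

    data Allowed : ∀ {m} → Vec (V G) m → Set where
      one  : ∀ {x} → Allowed (x ∷ [])
      cons : ∀ {m x y} {xs : Vec (V G) m} → Adj G x y → Allowed (y ∷ xs) →
             Allowed (x ∷ y ∷ xs)

    PathChain : ℕ → Set c
    PathChain n = Comb (Tuple n)

    _≈Path_ : ∀ {n} → PathChain n → PathChain n → Set (c ⊔ ℓ)
    _≈Path_ = EqMod tupleEq HasRepeat

    ∂Path : ∀ {n} → PathChain (suc n) → PathChain n
    ∂Path {n} = concatMap λ { (r , v) → map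
      (λ i → sgn (toℕ i) r , removeAt v i) (allFin (suc (suc n))) }

    -- membership in the submodule C̃_n(G) generated by allowed paths
    InTilde : ∀ {n} → PathChain n → Set (c ⊔ ℓ)
    InTilde x = Σ[ z ∈ PathChain _ ] (All (λ p → Allowed (proj₂ p)) z × (x ≈Path z))

    -- membership in C^Path_n(G) (for n ≥ 1; for n = 0 it is just C̃_0)
    InΩ : ∀ {n} → PathChain (suc n) → Set (c ⊔ ℓ)
    InΩ x = InTilde x × InTilde (∂Path x)

    PathHomologyVanishesAt : ℕ → Set (c ⊔ ℓ)
    PathHomologyVanishesAt zero = Level.Lift _ ⊤ -- degree 0 not considered
    PathHomologyVanishesAt (suc n) =
      ∀ (x : PathChain (suc n)) → InΩ x → ∂Path x ≈Path [] →
        Σ[ y ∈ PathChain (suc (suc n)) ] (InΩ y × (∂Path y ≈Path x))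

module Submission where

-- Both homologies are invariant under one-step homotopies.  If the graph maps f and g agree
-- up to an edge at every vertex, the prism operator H (a cube σ goes to the
-- cube with faces f ∘ σ and g ∘ σ; a path (v₀ … vₙ) goes to Σᵢ (−1)ⁱ (f v₀ … f vᵢ g vᵢ … g vₙ))
-- satisfies ∂H + H∂ = g − f and preserves degenerate cubes, repeated and allowed paths, so
-- if g sends every cycle of positive degree to a boundary, so does f.  A constant map sends
-- such cycles to degenerate chains, and each of the graphs is joined to a constant map by
-- finitely many one-step homotopies starting at the identity: a complete graph collapses
-- onto a vertex, Q_d clears one coordinate at a time, and a tree retracts along the unique
-- simple routes to a root.

open import Defs
open import Level using (0ℓ; _⊔_)
open import Algebra.Bundles using (CommutativeRing)
open import Data.Bool using (Bool; true; false; if_then_else_; not; T)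
import Data.Bool as Bool
open import Data.Nat using (ℕ; zero; suc; _<_; _≤_; s≤s)
import Data.Nat as ℕ
open import Data.Nat.Properties using (≤-trans; ≤-refl)
import Data.Nat.Properties as ℕₚ
open import Data.Fin using (Fin; zero; suc; toℕ; inject₁; fromℕ)
open import Data.Vec using (Vec; []; _∷_; removeAt)
import Data.Vec as Vec
open import Data.Vec.Properties using (≡-dec)
import Data.Vec.Properties as Vecₚ
open import Data.List using (List; []; _∷_; _++_; map; concat; concatMap; length; filter; lookup; allFin)
open import Data.List.Properties using (length-filter; map-++; concatMap-++; ++-identityʳ; map-tabulate; map-∘; map-cong; ∷-injectiveˡ)
open import Data.List.Relation.Unary.All using (All; []; _∷_)
import Data.List.Relation.Unary.All as All
import Data.List.Relation.Unary.All.Properties as Allₚ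
open import Data.List.Relation.Unary.Any using (here; there)
open import Data.List.Relation.Binary.Pointwise using (Pointwise; []; _∷_)
open import Data.List.Membership.Propositional using (_∈_; _∉_)
open import Data.List.Membership.Propositional.Properties using (∈-++⁺ˡ; ∈-++⁺ʳ; ∈-++⁻; ∈-lookup)
open import Data.Maybe using (Maybe; just; nothing)
import Data.Maybe as Maybe
open import Data.Product using (Σ-syntax; _×_; _,_; proj₁; proj₂; map₁; map₂)
open import Data.Sum using (_⊎_; inj₁; inj₂)
open import Data.Empty using (⊥; ⊥-elim)
open import Function using (_∘_; _∘′_; id)
open import Relation.Binary.Bundles using (DecSetoid; Setoid)
open import Relation.Binary.Structures using (IsEquivalence)
open import Relation.Nullary using (¬_; yes; no; does; ¬?; contradiction)
open import Relation.Nullary.Decidable using (dec-true)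
open import Relation.Binary.PropositionalEquality as ≡ using (_≡_; _≢_)
open import Relation.Binary.PropositionalEquality.Properties using (decSetoid)

module FreeModule {c ℓ} (R : CommutativeRing c ℓ) where

  open CommutativeRing R
  open import Algebra.Properties.Ring ring using (-0#≈0#; -‿+-comm; -‿involutive; -‿distribˡ-*; -‿distribʳ-*)
  open import Algebra.Properties.Group +-group using (x∙y⁻¹≈ε⇒x≈y; \\-leftDividesˡ; \\-leftDividesʳ)
  open import Algebra.Properties.CommutativeSemigroup +-commutativeSemigroup using (interchange; x∙yz≈y∙xz)
  open import Relation.Binary.Reasoning.Setoid setoid
  open Chains R public using (Comb; coeff; EqMod; sgn)

  neg : {X : Set} → Comb X → Comb X
  neg = map (map₁ (-_))

  relabel : {X Y : Set} → (X → Y) → Comb X → Comb Y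
  relabel f = map (map₂ f)

  scale : {X : Set} → Carrier → Comb X → Comb X
  scale r = map (map₁ (r *_))

  bind : {X Y : Set} → (Carrier → X → Comb Y) → Comb X → Comb Y
  bind T = concatMap (λ p → T (proj₁ p) (proj₂ p))

  IsAdditive : {X Y : Set} → (Comb X → Comb Y) → Set c
  IsAdditive L = ∀ xs ys → L (xs ++ ys) ≡ L xs ++ L ys

  neg-additive : {X : Set} → IsAdditive (neg {X})
  neg-additive = map-++ (map₁ (-_))

  relabel-additive : {X Y : Set} (f : X → Y) → IsAdditive (relabel f)
  relabel-additive f = map-++ (map₂ f)

  bind-additive : {X Y : Set} (T : Carrier → X → Comb Y) → IsAdditive (bind T)
  bind-additive T = concatMap-++ _

  ∘-additive : {X Y Z : Set} {L : Comb Y → Comb Z} {K : Comb X → Comb Y} → IsAdditive L → IsAdditive K → IsAdditive (L ∘ K)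
  ∘-additive {L = L} {K} aL aK xs ys = ≡.trans (≡.cong L (aK xs ys)) (aL (K xs) (K ys))

  sgn-neg : ∀ k r → sgn k (- r) ≈ - sgn k r
  sgn-neg zero    r = refl
  sgn-neg (suc k) r = -‿cong (sgn-neg k r)

  -- ±-sums of variables, compared by cancelling opposite literals; they certify the
  -- rearrangements of sums of combinations used below
  module Words where

    infixl 6 _⊕_
    data Word : Set where
      var : ℕ → Word
      _⊕_ : Word → Word → Word
      ⊝_  : Word → Word
      ε   : Word

    ⟦_⟧ : Word → (ℕ → Carrier) → Carrier
    ⟦ var i ⟧ σ = σ i
    ⟦ u ⊕ w ⟧ σ = ⟦ u ⟧ σ + ⟦ w ⟧ σ
    ⟦ ⊝ w ⟧   σ = - ⟦ w ⟧ σ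
    ⟦ ε ⟧     σ = 0#

    Literal : Set
    Literal = Bool × ℕ

    flip : Literal → Literal
    flip = map₁ not

    ⟦_⟧ᴸ : Literal → (ℕ → Carrier) → Carrier
    ⟦ true  , i ⟧ᴸ σ = σ i
    ⟦ false , i ⟧ᴸ σ = - σ i

    ⟦_⟧* : List Literal → (ℕ → Carrier) → Carrier
    ⟦ []     ⟧* σ = 0#
    ⟦ l ∷ ls ⟧* σ = ⟦ l ⟧ᴸ σ + ⟦ ls ⟧* σ

    literals : Word → List Literal
    literals (var i) = (true , i) ∷ []
    literals (u ⊕ w) = literals u ++ literals w
    literals (⊝ w)   = map flip (literals w)
    literals ε       = []

    ⟦⟧*-++ : ∀ ls ms σ → ⟦ ls ++ ms ⟧* σ ≈ ⟦ ls ⟧* σ + ⟦ ms ⟧* σ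
    ⟦⟧*-++ []       ms σ = sym (+-identityˡ _)
    ⟦⟧*-++ (l ∷ ls) ms σ = trans (+-congˡ (⟦⟧*-++ ls ms σ)) (sym (+-assoc _ _ _))

    ⟦flip⟧ᴸ : ∀ l σ → ⟦ flip l ⟧ᴸ σ ≈ - ⟦ l ⟧ᴸ σ
    ⟦flip⟧ᴸ (true  , i) σ = refl
    ⟦flip⟧ᴸ (false , i) σ = sym (-‿involutive _)

    ⟦map-flip⟧* : ∀ ls σ → ⟦ map flip ls ⟧* σ ≈ - ⟦ ls ⟧* σ
    ⟦map-flip⟧* []       σ = sym -0#≈0#
    ⟦map-flip⟧* (l ∷ ls) σ = trans (+-cong (⟦flip⟧ᴸ l σ) (⟦map-flip⟧* ls σ)) (-‿+-comm _ _)

    literals-sound : ∀ w σ → ⟦ w ⟧ σ ≈ ⟦ literals w ⟧* σ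
    literals-sound (var i) σ = sym (+-identityʳ _)
    literals-sound (u ⊕ w) σ = trans (+-cong (literals-sound u σ) (literals-sound w σ)) (sym (⟦⟧*-++ (literals u) _ σ))
    literals-sound (⊝ w)   σ = trans (-‿cong (literals-sound w σ)) (sym (⟦map-flip⟧* (literals w) σ))
    literals-sound ε       σ = refl

    cancel : Literal → List Literal → Maybe (List Literal)
    cancel l [] = nothing
    cancel (s , i) ((t , j) ∷ ms) with t Bool.≟ not s | j ℕ.≟ i
    ... | yes _ | yes _ = just ms
    ... | _     | _     = Maybe.map ((t , j) ∷_) (cancel (s , i) ms)

    cancel-sound : ∀ l ms ms′ σ → cancel l ms ≡ just ms′ → ⟦ l ⟧ᴸ σ + ⟦ ms ⟧* σ ≈ ⟦ ms′ ⟧* σ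
    cancel-skip-sound : ∀ l m ms ms′ σ → Maybe.map (m ∷_) (cancel l ms) ≡ just ms′ →
                        ⟦ l ⟧ᴸ σ + ⟦ m ∷ ms ⟧* σ ≈ ⟦ ms′ ⟧* σ

    cancel-sound l [] ms′ σ ()
    cancel-sound (s , i) ((t , j) ∷ ms) ms′ σ eq with t Bool.≟ not s | j ℕ.≟ i
    cancel-sound (true  , i) ((false , i) ∷ ms) ms σ ≡.refl | yes ≡.refl | yes ≡.refl = \\-leftDividesˡ _ _
    cancel-sound (false , i) ((true  , i) ∷ ms) ms σ ≡.refl | yes ≡.refl | yes ≡.refl = \\-leftDividesʳ _ _
    ... | yes _ | no _ = cancel-skip-sound (s , i) (t , j) ms ms′ σ eq
    ... | no _  | _    = cancel-skip-sound (s , i) (t , j) ms ms′ σ eq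

    cancel-skip-sound l m ms ms′ σ eq with cancel l ms in e
    cancel-skip-sound l m ms _ σ ≡.refl | just ms″ = trans (x∙yz≈y∙xz _ _ _) (+-congˡ (cancel-sound l ms ms″ σ e))

    -- the ℕ argument is fuel: a list of length k needs at most k cancellations
    cancels : ℕ → List Literal → Bool
    cancels _       []       = true
    cancels zero    (_ ∷ _)  = false
    cancels (suc k) (l ∷ ls) with cancel l ls
    ... | just ls′ = cancels k ls′
    ... | nothing  = false

    cancels-sound : ∀ k ls σ → T (cancels k ls) → ⟦ ls ⟧* σ ≈ 0#
    cancels-sound _       []       σ _ = refl
    cancels-sound (suc k) (l ∷ ls) σ t with cancel l ls in e
    ... | just ls′ = trans (cancel-sound l ls ls′ σ e) (cancels-sound k ls′ σ t)

    _=ʷ_ : Word → Word → Bool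
    u =ʷ w = cancels (length (literals (u ⊕ ⊝ w))) (literals (u ⊕ ⊝ w))

    =ʷ-sound : ∀ u w σ → T (u =ʷ w) → ⟦ u ⟧ σ ≈ ⟦ w ⟧ σ
    =ʷ-sound u w σ t = x∙y⁻¹≈ε⇒x≈y _ _
      (trans (literals-sound (u ⊕ ⊝ w) σ) (cancels-sound _ (literals (u ⊕ ⊝ w)) σ t))

  open Words public

  ⟦_⟧ᶜ : {X : Set} → Word → (ℕ → Comb X) → Comb X
  ⟦ var i ⟧ᶜ ρ = ρ i
  ⟦ u ⊕ w ⟧ᶜ ρ = ⟦ u ⟧ᶜ ρ ++ ⟦ w ⟧ᶜ ρ
  ⟦ ⊝ w ⟧ᶜ   ρ = neg (⟦ w ⟧ᶜ ρ)
  ⟦ ε ⟧ᶜ     ρ = []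

  relabel-neg : {X Y : Set} (h : X → Y) (xs : Comb X) → relabel h (neg xs) ≡ neg (relabel h xs)
  relabel-neg h []       = ≡.refl
  relabel-neg h (_ ∷ xs) = ≡.cong (_ ∷_) (relabel-neg h xs)

  relabel-scale : {X Y : Set} (h : X → Y) (r : Carrier) (xs : Comb X) → relabel h (scale r xs) ≡ scale r (relabel h xs)
  relabel-scale h r []       = ≡.refl
  relabel-scale h r (_ ∷ xs) = ≡.cong (_ ∷_) (relabel-scale h r xs)

  relabel-⟦⟧ᶜ : {X Y : Set} (h : X → Y) (w : Word) (ρ : ℕ → Comb X) → relabel h (⟦ w ⟧ᶜ ρ) ≡ ⟦ w ⟧ᶜ (relabel h ∘ ρ)
  relabel-⟦⟧ᶜ h (var i) ρ = ≡.refl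
  relabel-⟦⟧ᶜ h (u ⊕ w) ρ =
    ≡.trans (relabel-additive h (⟦ u ⟧ᶜ ρ) _) (≡.cong₂ _++_ (relabel-⟦⟧ᶜ h u ρ) (relabel-⟦⟧ᶜ h w ρ))
  relabel-⟦⟧ᶜ h (⊝ w)   ρ = ≡.trans (relabel-neg h (⟦ w ⟧ᶜ ρ)) (≡.cong neg (relabel-⟦⟧ᶜ h w ρ))
  relabel-⟦⟧ᶜ h ε       ρ = ≡.refl

  module Coefficients (S : DecSetoid 0ℓ 0ℓ) where

    open DecSetoid S using ()
      renaming (Carrier to X; _≈_ to _≈ᵍ_; _≟_ to _≟ᵍ_; refl to reflᵍ; sym to symᵍ; trans to transᵍ)

    _==_ : X → X → Bool
    x == y = does (x ≟ᵍ y)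

    cf : Comb X → X → Carrier
    cf = coeff _==_

    ==-resp : ∀ {x y} g → x ≈ᵍ y → (x == g) ≡ (y == g)
    ==-resp {x} {y} g x≈y with x ≟ᵍ g | y ≟ᵍ g
    ... | yes _   | yes _   = ≡.refl
    ... | no _    | no _    = ≡.refl
    ... | yes x≈g | no y≉g  = contradiction (transᵍ (symᵍ x≈y) x≈g) y≉g
    ... | no x≉g  | yes y≈g = contradiction (transᵍ x≈y y≈g) x≉g

    infix 4 _≃_
    record _≃_ (xs ys : Comb X) : Set ℓ where
      constructor mk≃
      field coeff-≈ : ∀ g → cf xs g ≈ cf ys g
    open _≃_ public

    ≃-isEquivalence : IsEquivalence _≃_
    ≃-isEquivalence = record
      { refl  = mk≃ λ g → refl
      ; sym   = λ (mk≃ p) → mk≃ λ g → sym (p g)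
      ; trans = λ (mk≃ p) (mk≃ q) → mk≃ λ g → trans (p g) (q g)
      }

    module ≃ = IsEquivalence ≃-isEquivalence

    ≃-setoid : Setoid c ℓ
    ≃-setoid = record { isEquivalence = ≃-isEquivalence }

    cf-++ : ∀ xs ys g → cf (xs ++ ys) g ≈ cf xs g + cf ys g
    cf-++ []             ys g = sym (+-identityˡ _)
    cf-++ ((r , x) ∷ xs) ys g = trans (+-congˡ (cf-++ xs ys g)) (sym (+-assoc _ _ _))

    cf-neg : ∀ xs g → cf (neg xs) g ≈ - cf xs g
    cf-neg []             g = sym -0#≈0#
    cf-neg ((r , x) ∷ xs) g = trans (+-cong (if-neg (x == g)) (cf-neg xs g)) (-‿+-comm _ _)
      where
      if-neg : ∀ b → (if b then - r else 0#) ≈ - (if b then r else 0#)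
      if-neg true  = refl
      if-neg false = sym -0#≈0#

    ≃-++ : ∀ {xs xs′ ys ys′} → xs ≃ xs′ → ys ≃ ys′ → xs ++ ys ≃ xs′ ++ ys′
    ≃-++ {xs} {xs′} {ys} {ys′} (mk≃ p) (mk≃ q) = mk≃ λ g → begin
      cf (xs ++ ys) g     ≈⟨ cf-++ xs ys g ⟩
      cf xs g + cf ys g   ≈⟨ +-cong (p g) (q g) ⟩
      cf xs′ g + cf ys′ g ≈⟨ cf-++ xs′ ys′ g ⟨
      cf (xs′ ++ ys′) g   ∎

    ≃-neg : ∀ {xs ys} → xs ≃ ys → neg xs ≃ neg ys
    ≃-neg {xs} {ys} (mk≃ p) = mk≃ λ g → trans (cf-neg xs g) (trans (-‿cong (p g)) (sym (cf-neg ys g)))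

    cf-scale : ∀ r xs g → cf (scale r xs) g ≈ r * cf xs g
    cf-scale r []             g = sym (zeroʳ r)
    cf-scale r ((s , x) ∷ xs) g = trans (+-cong (if-scale (x == g)) (cf-scale r xs g)) (sym (distribˡ r _ _))
      where
      if-scale : ∀ b → (if b then r * s else 0#) ≈ r * (if b then s else 0#)
      if-scale true  = refl
      if-scale false = sym (zeroʳ r)

    neg-scale : ∀ r xs → neg (scale r xs) ≃ scale r (neg xs)
    neg-scale r xs = mk≃ λ g → begin
      cf (neg (scale r xs)) g ≈⟨ cf-neg (scale r xs) g ⟩
      - cf (scale r xs) g     ≈⟨ -‿cong (cf-scale r xs g) ⟩
      - (r * cf xs g)         ≈⟨ -‿distribʳ-* r (cf xs g) ⟩
      r * - cf xs g           ≈⟨ *-congˡ (cf-neg xs g) ⟨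
      r * cf (neg xs) g       ≈⟨ cf-scale r (neg xs) g ⟨
      cf (scale r (neg xs)) g ∎

    neg-involutive : ∀ xs → neg (neg xs) ≃ xs
    neg-involutive xs = mk≃ λ g → trans (cf-neg (neg xs) g) (trans (-‿cong (cf-neg xs g)) (-‿involutive _))

    _≈ᵗ_ : Carrier × X → Carrier × X → Set ℓ
    (r , x) ≈ᵗ (s , y) = r ≈ s × x ≈ᵍ y

    Pointwise⇒≃ : ∀ {xs ys} → Pointwise _≈ᵗ_ xs ys → xs ≃ ys
    Pointwise⇒≃ [] = ≃.refl
    Pointwise⇒≃ {(r , x) ∷ xs} {(s , y) ∷ ys} ((r≈s , x≈y) ∷ ps) = mk≃ λ g →
      +-cong (≡.subst (λ b → (if x == g then r else 0#) ≈ (if b then s else 0#)) (==-resp g x≈y) (if-cong (x == g)))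
             (coeff-≈ (Pointwise⇒≃ ps) g)
      where
      if-cong : ∀ b → (if b then r else 0#) ≈ (if b then s else 0#)
      if-cong true  = r≈s
      if-cong false = refl

    -- a linear functional that respects the equivalence of generators only sees coefficients

    sumOver : (Carrier → X → Carrier) → Comb X → Carrier
    sumOver ψ []             = 0#
    sumOver ψ ((r , x) ∷ xs) = ψ r x + sumOver ψ xs

    eval : (X → Carrier) → Comb X → Carrier
    eval φ = sumOver (λ r x → r * φ x)

    Respects : (X → Carrier) → Set ℓ
    Respects φ = ∀ {x y} → x ≈ᵍ y → φ x ≈ φ y

    sumOver-cong : ∀ {ψ ψ′} xs → (∀ r x → ψ r x ≈ ψ′ r x) → sumOver ψ xs ≈ sumOver ψ′ xs
    sumOver-cong []             e = refl
    sumOver-cong ((r , x) ∷ xs) e = +-cong (e r x) (sumOver-cong xs e)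

    sumOver-++ : ∀ ψ xs ys → sumOver ψ (xs ++ ys) ≈ sumOver ψ xs + sumOver ψ ys
    sumOver-++ ψ []             ys = sym (+-identityˡ _)
    sumOver-++ ψ ((r , x) ∷ xs) ys = trans (+-congˡ (sumOver-++ ψ xs ys)) (sym (+-assoc _ _ _))

    cf-sumOver : ∀ xs g → cf xs g ≈ sumOver (λ r x → if x == g then r else 0#) xs
    cf-sumOver []             g = refl
    cf-sumOver ((r , x) ∷ xs) g = +-congˡ (cf-sumOver xs g)

    cf-absent : ∀ {xs g} → All (λ p → ¬ (g ≈ᵍ proj₂ p)) xs → cf xs g ≈ 0#
    cf-absent [] = refl
    cf-absent {(r , x) ∷ xs} {g} (g≉x ∷ ps) with x ≟ᵍ g
    ... | yes x≈g = contradiction (symᵍ x≈g) g≉x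
    ... | no _    = trans (+-identityˡ _) (cf-absent ps)

    module _ (h : X) where

      Like Unlike : Carrier × X → Set
      Like   p = h ≈ᵍ proj₂ p
      Unlike p = ¬ (h ≈ᵍ proj₂ p)

      like : Comb X → Comb X
      like = filter (λ p → h ≟ᵍ proj₂ p)

      unlike : Comb X → Comb X
      unlike = filter (λ p → ¬? (h ≟ᵍ proj₂ p))

      sumOver-partition : ∀ ψ xs → sumOver ψ xs ≈ sumOver ψ (like xs) + sumOver ψ (unlike xs)
      sumOver-partition ψ [] = sym (+-identityˡ _)
      sumOver-partition ψ ((r , x) ∷ xs) with h ≟ᵍ x
      ... | yes _ = trans (+-congˡ (sumOver-partition ψ xs)) (sym (+-assoc _ _ _))
      ... | no _  = trans (+-congˡ (sumOver-partition ψ xs)) (x∙yz≈y∙xz _ _ _)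

      cf-like : ∀ {xs g} → h ≈ᵍ g → All Like xs → cf xs g ≈ sumOver (λ r _ → r) xs
      cf-like h≈g [] = refl
      cf-like {(r , x) ∷ xs} {g} h≈g (h≈x ∷ ps) with x ≟ᵍ g
      ... | yes _  = +-congˡ (cf-like h≈g ps)
      ... | no x≉g = contradiction (transᵍ (symᵍ h≈x) h≈g) x≉g

      eval-like : ∀ {φ xs} → Respects φ → All Like xs → eval φ xs ≈ sumOver (λ r _ → r) xs * φ h
      eval-like resp [] = sym (zeroˡ _)
      eval-like resp (h≈x ∷ ps) = trans (+-cong (*-congˡ (resp (symᵍ h≈x))) (eval-like resp ps)) (sym (distribʳ _ _ _))

      like-all : ∀ xs → All Like (like xs)
      like-all = Allₚ.all-filter (λ p → h ≟ᵍ proj₂ p)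

      unlike-all : ∀ xs → All Unlike (unlike xs)
      unlike-all = Allₚ.all-filter (λ p → ¬? (h ≟ᵍ proj₂ p))

      cf-partition : ∀ xs g → cf xs g ≈ cf (like xs) g + cf (unlike xs) g
      cf-partition xs g = trans (cf-sumOver xs g)
        (trans (sumOver-partition _ xs) (sym (+-cong (cf-sumOver (like xs) g) (cf-sumOver (unlike xs) g))))

      class-total-zero : ∀ r ys → cf ((r , h) ∷ ys) h ≈ 0# → r + sumOver (λ r _ → r) (like ys) ≈ 0#
      class-total-zero r ys cf0 = begin
        r + total                                   ≈⟨ +-congˡ (+-identityʳ _) ⟨
        r + (total + 0#)                            ≈⟨ +-congˡ (+-cong (cf-like reflᵍ (like-all ys)) (cf-absent (unlike-all ys))) ⟨
        r + (cf (like ys) h + cf (unlike ys) h)     ≈⟨ +-congˡ (cf-partition ys h) ⟨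
        r + cf ys h                                 ≡⟨ ≡.cong (λ b → (if b then r else 0#) + cf ys h) (dec-true (h ≟ᵍ h) reflᵍ) ⟨
        cf ((r , h) ∷ ys) h                         ≈⟨ cf0 ⟩
        0#                                          ∎
        where total = sumOver (λ r _ → r) (like ys)

      unlike-cf-zero : ∀ r ys → (∀ g → cf ((r , h) ∷ ys) g ≈ 0#) → ∀ g → cf (unlike ys) g ≈ 0#
      unlike-cf-zero r ys cf0 g with h ≟ᵍ g
      ... | yes h≈g = cf-absent (All.map (λ h≉x g≈x → h≉x (transᵍ h≈g g≈x)) (unlike-all ys))
      ... | no h≉g  = begin
        cf (unlike ys) g                     ≈⟨ +-identityˡ _ ⟨
        0# + cf (unlike ys) g                ≈⟨ +-congʳ (cf-absent (All.map (λ h≈x g≈x → h≉g (transᵍ h≈x (symᵍ g≈x)))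
                                                                         (like-all ys))) ⟨
        cf (like ys) g + cf (unlike ys) g    ≈⟨ cf-partition ys g ⟨
        cf ys g                              ≈⟨ +-identityˡ _ ⟨
        0# + cf ys g                         ≡⟨ ≡.cong (_+ cf ys g) head-cf ⟨
        cf ((r , h) ∷ ys) g                  ≈⟨ cf0 g ⟩
        0#                                   ∎
        where
        head-cf : (if h == g then r else 0#) ≡ 0#
        head-cf with h ≟ᵍ g
        ... | yes h≈g = contradiction h≈g h≉g
        ... | no _    = ≡.refl

    eval-zero : ∀ k xs → length xs ≤ k → (∀ g → cf xs g ≈ 0#) → ∀ {φ} → Respects φ → eval φ xs ≈ 0#
    eval-zero _       []             _         _   _ = refl
    eval-zero (suc k) ((r , h) ∷ ys) (s≤s len) cf0 {φ} resp = begin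
      r * φ h + eval φ ys                                   ≈⟨ +-congˡ (sumOver-partition h _ ys) ⟩
      r * φ h + (eval φ (like h ys) + eval φ (unlike h ys)) ≈⟨ +-congˡ (+-cong (eval-like h resp (like-all h ys)) unlike-zero) ⟩
      r * φ h + (total * φ h + 0#)                          ≈⟨ +-congˡ (+-identityʳ _) ⟩
      r * φ h + total * φ h                                 ≈⟨ distribʳ _ _ _ ⟨
      (r + total) * φ h                                     ≈⟨ *-congʳ (class-total-zero h r ys (cf0 h)) ⟩
      0# * φ h                                              ≈⟨ zeroˡ _ ⟩
      0#                                                    ∎
      where
      total = sumOver (λ r _ → r) (like h ys)
      unlike-zero : eval φ (unlike h ys) ≈ 0#
      unlike-zero = eval-zero k (unlike h ys) (≤-trans (length-filter _ ys) len) (unlike-cf-zero h r ys cf0) resp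

    eval-resp-≃ : ∀ {φ} → Respects φ → ∀ {xs ys} → xs ≃ ys → eval φ xs ≈ eval φ ys
    eval-resp-≃ {φ} resp {xs} {ys} (mk≃ p) = x∙y⁻¹≈ε⇒x≈y _ _ (begin
      eval φ xs + - eval φ ys        ≈⟨ +-congˡ (eval-neg ys) ⟨
      eval φ xs + eval φ (neg ys)    ≈⟨ sumOver-++ _ xs (neg ys) ⟨
      eval φ (xs ++ neg ys)          ≈⟨ eval-zero _ (xs ++ neg ys) ≤-refl difference-zero resp ⟩
      0#                             ∎)
      where
      eval-neg : ∀ zs → eval φ (neg zs) ≈ - eval φ zs
      eval-neg []             = sym -0#≈0#
      eval-neg ((r , x) ∷ zs) = trans (+-cong (sym (-‿distribˡ-* r (φ x))) (eval-neg zs)) (-‿+-comm _ _)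
      difference-zero : ∀ g → cf (xs ++ neg ys) g ≈ 0#
      difference-zero g = trans (cf-++ xs (neg ys) g) (trans (+-cong (p g) (cf-neg ys g)) (-‿inverseʳ _))

    cf-⟦⟧ᶜ : ∀ w ρ g → cf (⟦ w ⟧ᶜ ρ) g ≈ ⟦ w ⟧ (λ i → cf (ρ i) g)
    cf-⟦⟧ᶜ (var i) ρ g = refl
    cf-⟦⟧ᶜ (u ⊕ w) ρ g = trans (cf-++ (⟦ u ⟧ᶜ ρ) _ g) (+-cong (cf-⟦⟧ᶜ u ρ g) (cf-⟦⟧ᶜ w ρ g))
    cf-⟦⟧ᶜ (⊝ w)   ρ g = trans (cf-neg (⟦ w ⟧ᶜ ρ) g) (-‿cong (cf-⟦⟧ᶜ w ρ g))
    cf-⟦⟧ᶜ ε       ρ g = refl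

    rearrange : ∀ u w ρ → T (u =ʷ w) → ⟦ u ⟧ᶜ ρ ≃ ⟦ w ⟧ᶜ ρ
    rearrange u w ρ t = mk≃ λ g →
      trans (cf-⟦⟧ᶜ u ρ g) (trans (=ʷ-sound u w _ t) (sym (cf-⟦⟧ᶜ w ρ g)))

    record IsAdditive≃ {Y : Set} (L : Comb Y → Comb X) : Set (c ⊔ ℓ) where
      constructor mkAdditive≃
      field ++-≃ : ∀ xs ys → L (xs ++ ys) ≃ L xs ++ L ys
    open IsAdditive≃ public

    additive-ext : ∀ {Y : Set} (L₁ L₂ : Comb Y → Comb X) → IsAdditive≃ L₁ → IsAdditive≃ L₂ → L₁ [] ≃ L₂ [] →
                   (∀ r y → L₁ ((r , y) ∷ []) ≃ L₂ ((r , y) ∷ [])) → ∀ ys → L₁ ys ≃ L₂ ys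
    additive-ext L₁ L₂ a₁ a₂ e₀ e₁ []             = e₀
    additive-ext L₁ L₂ a₁ a₂ e₀ e₁ ((r , y) ∷ ys) =
      ≃.trans (++-≃ a₁ _ ys) (≃.trans (≃-++ (e₁ r y) (additive-ext L₁ L₂ a₁ a₂ e₀ e₁ ys)) (≃.sym (++-≃ a₂ _ ys)))

    additive⇒additive≃ : ∀ {Y : Set} {L : Comb Y → Comb X} → IsAdditive L → IsAdditive≃ L
    additive⇒additive≃ a = mkAdditive≃ λ xs ys → ≃.reflexive (a xs ys)

    ++-interchange : ∀ as bs cs ds → (as ++ bs) ++ (cs ++ ds) ≃ (as ++ cs) ++ (bs ++ ds)
    ++-interchange as bs cs ds = rearrange ((var 0 ⊕ var 1) ⊕ (var 2 ⊕ var 3)) ((var 0 ⊕ var 2) ⊕ (var 1 ⊕ var 3)) ρ _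
      where
      ρ : ℕ → Comb X
      ρ 0 = as
      ρ 1 = bs
      ρ 2 = cs
      ρ _ = ds

    ++-additive≃ : ∀ {Y : Set} (A B : Comb Y → Comb X) → IsAdditive≃ A → IsAdditive≃ B → IsAdditive≃ (λ zs → A zs ++ B zs)
    ++-additive≃ A B aA aB = mkAdditive≃ λ xs ys →
      ≃.trans (≃-++ (++-≃ aA xs ys) (++-≃ aB xs ys)) (++-interchange (A xs) (A ys) (B xs) (B ys))

    neg-additive≃ : ∀ {Y : Set} (A : Comb Y → Comb X) → IsAdditive≃ A → IsAdditive≃ (neg ∘ A)
    neg-additive≃ A aA = mkAdditive≃ λ xs ys → ≃.trans (≃-neg (++-≃ aA xs ys)) (≃.reflexive (neg-additive (A xs) (A ys)))

    homotopy-formula-additive : ∀ {Y : Set} (G F K : Comb Y → Comb X) → IsAdditive G → IsAdditive F → IsAdditive K →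
                                IsAdditive≃ (λ ys → G ys ++ (neg (F ys) ++ neg (K ys)))
    homotopy-formula-additive G F K aG aF aK =
      ++-additive≃ G (λ ys → neg (F ys) ++ neg (K ys)) (additive⇒additive≃ aG)
        (++-additive≃ (neg ∘ F) (neg ∘ K) (neg-additive≃ F (additive⇒additive≃ aF)) (neg-additive≃ K (additive⇒additive≃ aK)))

    module Modulo (D : X → Set) where

      Negligible : Comb X → Set c
      Negligible = All (D ∘ proj₂)

      infix 4 _∼_
      record _∼_ (xs ys : Comb X) : Set (c ⊔ ℓ) where
        constructor mk∼
        field un∼ : EqMod _==_ D xs ys
      open _∼_ public

      ≃⇒∼ : ∀ {xs ys} → xs ≃ ys → xs ∼ ys
      ≃⇒∼ (mk≃ p) = mk∼ ([] , [] , λ g → trans (p g) (sym (+-identityʳ _)))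

      Negligible⇒∼[] : ∀ {xs} → Negligible xs → xs ∼ []
      Negligible⇒∼[] {xs} d = mk∼ (xs , d , λ g → sym (+-identityˡ _))

      ∼-isEquivalence : IsEquivalence _∼_
      ∼-isEquivalence = record
        { refl  = ≃⇒∼ ≃.refl
        ; sym   = λ {xs} {ys} (mk∼ (z , dz , p)) → mk∼ (neg z , Allₚ.map⁺ dz , λ g → sym (begin
            cf xs g + cf (neg z) g   ≈⟨ +-cong (p g) (cf-neg z g) ⟩
            cf ys g + cf z g + - cf z g ≈⟨ +-assoc _ _ _ ⟩
            cf ys g + (cf z g + - cf z g) ≈⟨ +-congˡ (-‿inverseʳ _) ⟩
            cf ys g + 0#             ≈⟨ +-identityʳ _ ⟩
            cf ys g                  ∎))
        ; trans = λ {xs} {ys} {zs} (mk∼ (u , du , p)) (mk∼ (w , dw , q)) → mk∼ (w ++ u , Allₚ.++⁺ dw du , λ g → begin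
            cf xs g                      ≈⟨ p g ⟩
            cf ys g + cf u g             ≈⟨ +-congʳ (q g) ⟩
            cf zs g + cf w g + cf u g    ≈⟨ +-assoc _ _ _ ⟩
            cf zs g + (cf w g + cf u g)  ≈⟨ +-congˡ (cf-++ w u g) ⟨
            cf zs g + cf (w ++ u) g      ∎)
        }

      module ∼ = IsEquivalence ∼-isEquivalence

      ∼-++ : ∀ {xs xs′ ys ys′} → xs ∼ xs′ → ys ∼ ys′ → xs ++ ys ∼ xs′ ++ ys′
      ∼-++ {xs} {xs′} {ys} {ys′} (mk∼ (u , du , p)) (mk∼ (w , dw , q)) = mk∼ (u ++ w , Allₚ.++⁺ du dw , λ g → begin
        cf (xs ++ ys) g                           ≈⟨ cf-++ xs ys g ⟩
        cf xs g + cf ys g                         ≈⟨ +-cong (p g) (q g) ⟩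
        (cf xs′ g + cf u g) + (cf ys′ g + cf w g) ≈⟨ interchange _ _ _ _ ⟩
        (cf xs′ g + cf ys′ g) + (cf u g + cf w g) ≈⟨ +-cong (cf-++ xs′ ys′ g) (cf-++ u w g) ⟨
        cf (xs′ ++ ys′) g + cf (u ++ w) g         ∎)

      ∼-neg : ∀ {xs ys} → xs ∼ ys → neg xs ∼ neg ys
      ∼-neg {xs} {ys} (mk∼ (u , du , p)) = mk∼ (neg u , Allₚ.map⁺ du , λ g → begin
        cf (neg xs) g               ≈⟨ cf-neg xs g ⟩
        - cf xs g                   ≈⟨ -‿cong (p g) ⟩
        - (cf ys g + cf u g)        ≈⟨ -‿+-comm _ _ ⟨
        - cf ys g + - cf u g        ≈⟨ +-cong (cf-neg ys g) (cf-neg u g) ⟨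
        cf (neg ys) g + cf (neg u) g ∎)

      ⟦⟧-∼ : ∀ w {ρ ρ′} → (∀ i → ρ i ∼ ρ′ i) → ⟦ w ⟧ᶜ ρ ∼ ⟦ w ⟧ᶜ ρ′
      ⟦⟧-∼ (var i) e = e i
      ⟦⟧-∼ (u ⊕ w) e = ∼-++ (⟦⟧-∼ u e) (⟦⟧-∼ w e)
      ⟦⟧-∼ (⊝ w)   e = ∼-neg (⟦⟧-∼ w e)
      ⟦⟧-∼ ε       e = ∼.refl

      -- if y fills g x and H is the prism operator of a one-step homotopy f ~ g, then y − H x fills f x
      homotopy-step : ∀ {∂y ∂Hx gx fx H∂x} → ∂y ∼ gx → ∂Hx ≃ gx ++ (neg fx ++ neg H∂x) → H∂x ∼ [] →
                      ∂y ++ neg ∂Hx ∼ fx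
      homotopy-step {gx = gx} {fx} {H∂x} ∂y∼gx prism H∂x∼0 =
        ∼.trans (∼-++ ∂y∼gx (≃⇒∼ (≃-neg prism)))
        (∼.trans (⟦⟧-∼ w atoms)
        (≃⇒∼ (≃.trans (rearrange w (var 1 ⊕ var 2) ρ′ _) (≃.reflexive (++-identityʳ fx)))))
        where
        w = var 0 ⊕ ⊝ (var 0 ⊕ (⊝ var 1 ⊕ ⊝ var 2))
        ρ ρ′ : ℕ → Comb X
        ρ 0 = gx
        ρ 1 = fx
        ρ _ = H∂x
        ρ′ 0 = gx
        ρ′ 1 = fx
        ρ′ _ = []
        atoms : ∀ i → ρ i ∼ ρ′ i
        atoms 0             = ∼.refl
        atoms 1             = ∼.refl
        atoms (suc (suc _)) = H∂x∼0

  module Linear (S₁ S₂ : DecSetoid 0ℓ 0ℓ) where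

    private
      module C₁ = Coefficients S₁
      module C₂ = Coefficients S₂
      X₁ = DecSetoid.Carrier S₁
      X₂ = DecSetoid.Carrier S₂
    open C₂ using (cf; _≃_; mk≃; coeff-≈)

    cf-bind : ∀ (T : Carrier → X₁ → Comb X₂) xs g → cf (bind T xs) g ≈ C₁.sumOver (λ r x → cf (T r x) g) xs
    cf-bind T []             g = refl
    cf-bind T ((r , x) ∷ xs) g = trans (C₂.cf-++ (T r x) (bind T xs) g) (+-congˡ (cf-bind T xs g))

    bind-neg : ∀ {T : Carrier → X₁ → Comb X₂} → (∀ r x → T (- r) x ≃ neg (T r x)) → ∀ xs → bind T (neg xs) ≃ neg (bind T xs)
    bind-neg {T} e []             = C₂.≃.refl
    bind-neg {T} e ((r , x) ∷ xs) =
      C₂.≃.trans (C₂.≃-++ (e r x) (bind-neg e xs)) (C₂.≃.reflexive (≡.sym (neg-additive (T r x) _)))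

    bind-resp-≃ : ∀ {T : Carrier → X₁ → Comb X₂} → (∀ r x → T r x ≃ scale r (T 1# x)) →
                  (∀ {x y} → DecSetoid._≈_ S₁ x y → T 1# x ≃ T 1# y) →
                  ∀ {xs ys} → xs C₁.≃ ys → bind T xs ≃ bind T ys
    bind-resp-≃ {T} lin resp {xs} {ys} xs≃ys = mk≃ λ g → begin
      cf (bind T xs) g                          ≈⟨ cf-bind T xs g ⟩
      C₁.sumOver (λ r x → cf (T r x) g) xs      ≈⟨ C₁.sumOver-cong xs (linear g) ⟩
      C₁.eval (λ x → cf (T 1# x) g) xs          ≈⟨ C₁.eval-resp-≃ (λ x≈y → coeff-≈ (resp x≈y) g) xs≃ys ⟩
      C₁.eval (λ x → cf (T 1# x) g) ys          ≈⟨ C₁.sumOver-cong ys (linear g) ⟨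
      C₁.sumOver (λ r x → cf (T r x) g) ys      ≈⟨ cf-bind T ys g ⟨
      cf (bind T ys) g                          ∎
      where
      linear : ∀ g r x → cf (T r x) g ≈ r * cf (T 1# x) g
      linear g r x = trans (coeff-≈ (lin r x) g) (C₂.cf-scale r (T 1# x) g)

    relabel-as-bind : ∀ (f : X₁ → X₂) xs → relabel f xs ≡ bind (λ r x → (r , f x) ∷ []) xs
    relabel-as-bind f []       = ≡.refl
    relabel-as-bind f (p ∷ xs) = ≡.cong (_ ∷_) (relabel-as-bind f xs)

    relabel-resp-≃ : ∀ {f : X₁ → X₂} → (∀ {x y} → DecSetoid._≈_ S₁ x y → DecSetoid._≈_ S₂ (f x) (f y)) →
                     ∀ {xs ys} → xs C₁.≃ ys → relabel f xs ≃ relabel f ys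
    relabel-resp-≃ {f} resp {xs} {ys} xs≃ys =
      C₂.≃.trans (C₂.≃.reflexive (relabel-as-bind f xs))
      (C₂.≃.trans (bind-resp-≃ (λ r x → C₂.Pointwise⇒≃ ((sym (*-identityʳ r) , DecSetoid.refl S₂) ∷ []))
                                (λ x≈y → C₂.Pointwise⇒≃ ((refl , resp x≈y) ∷ [])) xs≃ys)
                  (C₂.≃.reflexive (≡.sym (relabel-as-bind f ys))))

    module _ (D₁ : X₁ → Set) (D₂ : X₂ → Set) where
      private
        module M₁ = C₁.Modulo D₁
        module M₂ = C₂.Modulo D₂

      additive-resp-∼ : (L : Comb X₁ → Comb X₂) → (∀ {xs ys} → xs C₁.≃ ys → L xs ≃ L ys) →
                        IsAdditive L → (∀ {z} → M₁.Negligible z → M₂.Negligible (L z)) →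
                        ∀ {xs ys} → xs M₁.∼ ys → L xs M₂.∼ L ys
      additive-resp-∼ L resp additive negl {xs} {ys} (M₁.mk∼ (z , dz , p)) = M₂.mk∼ (L z , negl dz , λ g → begin
        cf (L xs) g          ≈⟨ coeff-≈ (resp (C₁.mk≃ λ g′ → trans (p g′) (sym (C₁.cf-++ ys z g′)))) g ⟩
        cf (L (ys ++ z)) g   ≡⟨ ≡.cong (λ w → cf w g) (additive ys z) ⟩
        cf (L ys ++ L z) g   ≈⟨ C₂.cf-++ (L ys) (L z) g ⟩
        cf (L ys) g + cf (L z) g ∎)

module Homotopy (G : Graph) where

  Near : V G → V G → Set
  Near x y = x ≡ y ⊎ Adj G x y

  Near-sym : ∀ {x y} → Near x y → Near y x
  Near-sym (inj₁ x≡y) = inj₁ (≡.sym x≡y)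
  Near-sym (inj₂ x~y) = inj₂ (Adj-sym G x~y)

  IsHom : (V G → V G) → Set
  IsHom f = ∀ {u v} → Adj G u v → Near (f u) (f v)

  IsHom-id : IsHom id
  IsHom-id = inj₂

  IsHom-near : ∀ {f} → IsHom f → ∀ {x y} → Near x y → Near (f x) (f y)
  IsHom-near hf (inj₁ x≡y) = inj₁ (≡.cong _ x≡y)
  IsHom-near hf (inj₂ x~y) = hf x~y

  OneStep : (V G → V G) → (V G → V G) → Set
  OneStep f g = ∀ v → Near (f v) (g v)

  data HomotopicToConstant : (V G → V G) → Set where
    constant : ∀ {f} → IsHom f → (∀ u v → f u ≡ f v) → HomotopicToConstant f
    via      : ∀ {f g} → IsHom f → OneStep f g → HomotopicToConstant g → HomotopicToConstant f

  HomotopicToConstant⇒IsHom : ∀ {f} → HomotopicToConstant f → IsHom f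
  HomotopicToConstant⇒IsHom (constant hf _) = hf
  HomotopicToConstant⇒IsHom (via hf _ _)   = hf

  Contractible : Set
  Contractible = HomotopicToConstant id

module CubicalVanishing {c ℓ} (R : CommutativeRing c ℓ) (G : Graph) where

  open CommutativeRing R hiding (zero)
  open FreeModule R
  open Chains R using (Cube; CubeChain; face; Degenerate; ∂Cube; CubeHomologyVanishesAt)
  open Homotopy G

  cubeSetoid : ℕ → DecSetoid 0ℓ 0ℓ
  cubeSetoid n = record
    { Carrier = Cube G n
    ; _≈_ = λ σ τ → ∀ a → proj₁ σ a ≡ proj₁ τ a
    ; isDecEquivalence = record
      { isEquivalence = record
        { refl  = λ a → ≡.refl
        ; sym   = λ p a → ≡.sym (p a)
        ; trans = λ p q a → ≡.trans (p a) (q a)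
        }
      ; _≟_ = λ σ τ → ∀Vec? n (λ a → _≟V_ G (proj₁ σ a) (proj₁ τ a))
      }
    }

  module _ {n : ℕ} where
    open Coefficients (cubeSetoid n) public
    open Modulo (Degenerate G) public

  postcompose : ∀ {n} (f : V G → V G) → IsHom f → Cube G n → Cube G n
  postcompose f hf (σ , hσ) = f ∘ σ , λ a~b → IsHom-near hf (hσ a~b)

  push : ∀ {n} (f : V G → V G) → IsHom f → CubeChain G n → CubeChain G n
  push f hf = relabel (postcompose f hf)

  faceTerms : ∀ {k} → Carrier → Cube G (suc k) → Fin (suc k) → CubeChain G k
  faceTerms r τ i = (sgn (suc (toℕ i)) r , face G i false τ) ∷ (- sgn (suc (toℕ i)) r , face G i true τ) ∷ []

  ∂term : ∀ {k} → Carrier → Cube G (suc k) → CubeChain G k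
  ∂term {k} r τ = concatMap (faceTerms r τ) (allFin (suc k))

  ∂term-neg : ∀ {k} r (τ : Cube G (suc k)) → ∂term (- r) τ ≃ neg (∂term r τ)
  ∂term-neg {k} r τ = Pointwise⇒≃ (go (allFin (suc k)))
    where
    go : ∀ is → Pointwise (_≈ᵗ_ {k}) (concatMap (faceTerms (- r) τ) is) (neg (concatMap (faceTerms r τ) is))
    go []      = []
    go (i ∷ is) = (sgn-neg (suc (toℕ i)) r , λ a → ≡.refl) ∷ (-‿cong (sgn-neg (suc (toℕ i)) r) , λ a → ≡.refl) ∷ go is

  ∂Cube-neg : ∀ {k} (xs : CubeChain G (suc k)) → ∂Cube G (neg xs) ≃ neg (∂Cube G xs)
  ∂Cube-neg {k} = Linear.bind-neg (cubeSetoid (suc k)) (cubeSetoid k) ∂term-neg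

  push-id : ∀ {k} (h : IsHom id) (xs : CubeChain G k) → push id h xs ≃ xs
  push-id {k} h xs = Pointwise⇒≃ (go xs)
    where
    go : ∀ xs → Pointwise (_≈ᵗ_ {k}) (push id h xs) xs
    go []       = []
    go (_ ∷ xs) = (refl , λ a → ≡.refl) ∷ go xs

  module Prism (f g : V G → V G) (hf : IsHom f) (hg : IsHom g) (f~g : OneStep f g) where

    prism : ∀ {n} → Cube G n → Cube G (suc n)
    prism {n} (σ , hσ) = P , P-hom
      where
      P : Vec Bool (suc n) → V G
      P (false ∷ a) = f (σ a)
      P (true  ∷ a) = g (σ a)
      P-hom : ∀ {a b} → QAdj a b → Near (P a) (P b)
      P-hom (here {b = false} {c = true}  _) = f~g _
      P-hom (here {b = true}  {c = false} _) = Near-sym (f~g _)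
      P-hom (here {b = false} {c = false} b≢c) = contradiction ≡.refl b≢c
      P-hom (here {b = true}  {c = true}  b≢c) = contradiction ≡.refl b≢c
      P-hom (there {b = false} a~b) = IsHom-near hf (hσ a~b)
      P-hom (there {b = true}  a~b) = IsHom-near hg (hσ a~b)

    H : ∀ {n} → CubeChain G n → CubeChain G (suc n)
    H = relabel prism

    prism-Degenerate : ∀ {k} {σ : Cube G k} → Degenerate G σ → Degenerate G (prism σ)
    prism-Degenerate {suc k} (i , e) = suc i , λ { (false ∷ a) → ≡.cong f (e a) ; (true ∷ a) → ≡.cong g (e a) }

    H-Negligible : ∀ {k} {z : CubeChain G k} → Negligible z → Negligible (H z)
    H-Negligible []       = []
    H-Negligible (d ∷ ds) = prism-Degenerate d ∷ H-Negligible ds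

    H-resp-∼ : ∀ {k} {xs ys : CubeChain G k} → xs ∼ ys → H xs ∼ H ys
    H-resp-∼ {k} = Linear.additive-resp-∼ (cubeSetoid k) (cubeSetoid (suc k)) (Degenerate G) (Degenerate G) H
      (Linear.relabel-resp-≃ (cubeSetoid k) (cubeSetoid (suc k))
        λ σ≈τ → λ { (false ∷ a) → ≡.cong f (σ≈τ a) ; (true ∷ a) → ≡.cong g (σ≈τ a) })
      (relabel-additive prism) H-Negligible

    ∂term-prism : ∀ {m} r (σ : Cube G (suc m)) →
                  ∂term r (prism σ) ≃ (- r , postcompose f hf σ) ∷ (- - r , postcompose g hg σ) ∷ neg (H (∂term r σ))
    ∂term-prism {m} r σ = Pointwise⇒≃
      ((refl , λ a → ≡.refl) ∷ (refl , λ a → ≡.refl) ∷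
        ≡.subst (λ is → Pointwise (_≈ᵗ_ {suc m}) (concat (map (faceTerms r (prism σ)) is)) (neg (H (∂term r σ))))
                (map-tabulate id suc) (higher-faces (allFin (suc m))))
      where
      higher-faces : ∀ is → Pointwise (_≈ᵗ_ {suc m}) (concat (map (faceTerms r (prism σ)) (map suc is)))
                                                     (neg (H (concatMap (faceTerms r σ) is)))
      higher-faces []       = []
      higher-faces (i ∷ is) = (refl , λ { (false ∷ a) → ≡.refl ; (true ∷ a) → ≡.refl })
                            ∷ (refl , λ { (false ∷ a) → ≡.refl ; (true ∷ a) → ≡.refl }) ∷ higher-faces is

    chain-prism : ∀ {m} (xs : CubeChain G (suc m)) →
                  ∂Cube G (H xs) ≃ push g hg xs ++ (neg (push f hf xs) ++ neg (H (∂Cube G xs)))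
    chain-prism {m} = additive-ext (∂Cube G ∘ H) (λ xs → push g hg xs ++ (neg (push f hf xs) ++ neg (H (∂Cube G xs))))
      (additive⇒additive≃ (∘-additive {L = ∂Cube G} {K = H} (bind-additive ∂term) (relabel-additive prism)))
      (homotopy-formula-additive (push g hg) (push f hf) (H ∘ ∂Cube G) (relabel-additive _) (relabel-additive _)
                                 (∘-additive {L = H} {K = ∂Cube G} (relabel-additive prism) (bind-additive ∂term)))
      ≃.refl
      single
      where
      open import Relation.Binary.Reasoning.Setoid (≃-setoid)
      single : ∀ r σ → ∂Cube G (H ((r , σ) ∷ [])) ≃
                       push g hg ((r , σ) ∷ []) ++ (neg (push f hf ((r , σ) ∷ [])) ++ neg (H (∂Cube G ((r , σ) ∷ []))))
      single r σ = begin
        ∂term r (prism σ) ++ []  ≡⟨ ++-identityʳ _ ⟩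
        ∂term r (prism σ)        ≈⟨ ∂term-prism r σ ⟩
        ⟦ ⊝ var 1 ⊕ (⊝ ⊝ var 0 ⊕ ⊝ var 2) ⟧ᶜ ρ
          ≈⟨ rearrange (⊝ var 1 ⊕ (⊝ ⊝ var 0 ⊕ ⊝ var 2)) (var 0 ⊕ (⊝ var 1 ⊕ ⊝ var 2)) ρ _ ⟩
        ⟦ var 0 ⊕ (⊝ var 1 ⊕ ⊝ var 2) ⟧ᶜ ρ ≡⟨ ≡.cong (λ z → ρ 0 ++ (neg (ρ 1) ++ neg (H z))) (++-identityʳ _) ⟨
        push g hg ((r , σ) ∷ []) ++ (neg (push f hf ((r , σ) ∷ [])) ++ neg (H (∂term r σ ++ []))) ∎
        where
        ρ : ℕ → CubeChain G (suc m)
        ρ 0 = (r , postcompose g hg σ) ∷ []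
        ρ 1 = (r , postcompose f hf σ) ∷ []
        ρ _ = H (∂term r σ)

  InducesZero : (f : V G → V G) → IsHom f → ℕ → Set (c ⊔ ℓ)
  InducesZero f hf m = ∀ (x : CubeChain G (suc m)) → ∂Cube G x ∼ [] →
                       Σ[ y ∈ CubeChain G (suc (suc m)) ] ∂Cube G y ∼ push f hf x

  constant-induces-zero : ∀ {f} (hf : IsHom f) → (∀ u v → f u ≡ f v) → ∀ m → InducesZero f hf m
  constant-induces-zero {f} hf f-const m x _ = [] , ∼.sym (Negligible⇒∼[] (negligible x))
    where
    negligible : ∀ x → Negligible (push f hf x)
    negligible []            = []
    negligible ((_ , σ) ∷ x) = (zero , λ a → f-const _ _) ∷ negligible x

  step-induces-zero : ∀ {f g} (hf : IsHom f) (hg : IsHom g) → OneStep f g → ∀ m → InducesZero g hg m → InducesZero f hf m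
  step-induces-zero {f} {g} hf hg f~g m g-zero x ∂x∼0 with g-zero x ∂x∼0
  ... | y , ∂y∼gx = y ++ neg (H x) , ∼.trans
      (≃⇒∼ (≃.trans (≃.reflexive (bind-additive ∂term y (neg (H x)))) (≃-++ ≃.refl (∂Cube-neg (H x)))))
      (homotopy-step ∂y∼gx (chain-prism x) (H-resp-∼ ∂x∼0))
    where open Prism f g hf hg f~g

  homotopic-to-constant-induces-zero : ∀ {f} (h : HomotopicToConstant f) m → InducesZero f (HomotopicToConstant⇒IsHom h) m
  homotopic-to-constant-induces-zero (constant hf f-const) = constant-induces-zero hf f-const
  homotopic-to-constant-induces-zero (via hf f~g h) m =
    step-induces-zero hf (HomotopicToConstant⇒IsHom h) f~g m (homotopic-to-constant-induces-zero h m)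

  cubical-homology-vanishes : Contractible → ∀ m → CubeHomologyVanishesAt G (suc m)
  cubical-homology-vanishes h m x ∂x≈0 with homotopic-to-constant-induces-zero h m x (mk∼ ∂x≈0)
  ... | y , ∂y∼x = y , un∼ (∼.trans ∂y∼x (≃⇒∼ (push-id _ x)))

module PathVanishing {c ℓ} (R : CommutativeRing c ℓ) (G : Graph) where

  open CommutativeRing R hiding (zero)
  open FreeModule R
  open Chains R using (Tuple; PathChain; HasRepeat; rep; skip; Allowed; one; cons; ∂Path; InTilde; InΩ; PathHomologyVanishesAt)
  open Homotopy G

  tupleSetoid : ℕ → DecSetoid 0ℓ 0ℓ
  tupleSetoid n = decSetoid (≡-dec {n = suc n} (_≟V_ G))

  module _ {n : ℕ} where
    open Coefficients (tupleSetoid n) public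
    open Modulo (HasRepeat G) public

  prepend : ∀ {n} → V G → PathChain G n → PathChain G (suc n)
  prepend a = relabel (a ∷_)

  push : ∀ {n} → (V G → V G) → PathChain G n → PathChain G n
  push f = relabel (Vec.map f)

  ∂term : ∀ {n} → Carrier → Tuple G (suc n) → PathChain G n
  ∂term {n} r t = map (λ i → sgn (toℕ i) r , removeAt t i) (allFin (suc (suc n)))

  ∂term-cons : ∀ {k} r a (w : Tuple G (suc k)) → ∂term r (a ∷ w) ≡ (r , w) ∷ prepend a (neg (∂term r w))
  ∂term-cons {k} r a w@(b ∷ _) = ≡.cong ((r , w) ∷_)
    (≡.trans (map-tabulate suc face) (≡.trans (≡.sym (map-tabulate id (face ∘ suc))) (≡.sym (shift (allFin (suc (suc k)))))))
    where
    face : Fin (suc (suc (suc k))) → Carrier × Tuple G (suc k)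
    face i = sgn (toℕ i) r , removeAt (a ∷ w) i
    shift : ∀ is → prepend a (neg (map (λ i → sgn (toℕ i) r , removeAt w i) is))
                 ≡ map (λ i → sgn (toℕ (suc i)) r , removeAt (a ∷ w) (suc i)) is
    shift []       = ≡.refl
    shift (i ∷ is) = ≡.cong (_ ∷_) (shift is)

  ∂term-neg : ∀ {k} r (t : Tuple G (suc k)) → ∂term (- r) t ≃ neg (∂term r t)
  ∂term-neg {k} r t = Pointwise⇒≃ (go (allFin (suc (suc k))))
    where
    go : ∀ is → Pointwise _≈ᵗ_ (map (λ i → sgn (toℕ i) (- r) , removeAt t i) is) (neg (map (λ i → sgn (toℕ i) r , removeAt t i) is))
    go []       = []
    go (i ∷ is) = (sgn-neg (toℕ i) r , ≡.refl) ∷ go is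

  ∂Path-neg : ∀ {k} (xs : PathChain G (suc k)) → ∂Path G (neg xs) ≃ neg (∂Path G xs)
  ∂Path-neg {k} = Linear.bind-neg (tupleSetoid (suc k)) (tupleSetoid k) ∂term-neg

  prepend-neg-++ : ∀ {n} a (xs ys : PathChain G n) → prepend a (neg (xs ++ ys)) ≡ prepend a (neg xs) ++ prepend a (neg ys)
  prepend-neg-++ a = ∘-additive {L = prepend a} {K = neg} (relabel-additive _) neg-additive

  ∂Path-prepend : ∀ {k} a (ys : PathChain G (suc k)) → ∂Path G (prepend a ys) ≃ ys ++ prepend a (neg (∂Path G ys))
  ∂Path-prepend a []             = ≃.refl
  ∂Path-prepend a ((r , t) ∷ ys) = ≃.trans (≃-++ (≃.reflexive (∂term-cons r a t)) (∂Path-prepend a ys))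
    (≃.trans (++-interchange ((r , t) ∷ []) (prepend a (neg (∂term r t))) ys (prepend a (neg (∂Path G ys))))
             (≃.reflexive (≡.cong (((r , t) ∷ ys) ++_) (≡.sym (prepend-neg-++ a (∂term r t) (∂Path G ys))))))

  removeAt-map : ∀ {n} (f : V G → V G) (t : Vec (V G) (suc n)) i → removeAt (Vec.map f t) i ≡ Vec.map f (removeAt t i)
  removeAt-map f (x ∷ t)     zero    = ≡.refl
  removeAt-map f (x ∷ y ∷ t) (suc i) = ≡.cong (f x ∷_) (removeAt-map f (y ∷ t) i)

  push-∂term : ∀ {n} (f : V G → V G) r (t : Tuple G (suc n)) → push f (∂term r t) ≡ ∂term r (Vec.map f t)
  push-∂term f r t = ≡.trans (≡.sym (map-∘ _)) (map-cong (λ i → ≡.cong (sgn (toℕ i) r ,_) (≡.sym (removeAt-map f t i))) _)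

  push-id : ∀ {n} (xs : PathChain G n) → push id xs ≡ xs
  push-id []             = ≡.refl
  push-id ((r , t) ∷ xs) = ≡.cong₂ (λ t′ xs′ → (r , t′) ∷ xs′) (Vecₚ.map-id t) (push-id xs)

  prepend-cong : ∀ {n} a {xs ys : PathChain G n} → xs ≃ ys → prepend a xs ≃ prepend a ys
  prepend-cong {n} a = Linear.relabel-resp-≃ (tupleSetoid n) (tupleSetoid (suc n)) (≡.cong (a ∷_))

  Admissible : ∀ {n} → Tuple G n → Set
  Admissible t = Allowed G t ⊎ HasRepeat G t

  HasRepeat-map : ∀ {n} (f : V G → V G) {t : Vec (V G) n} → HasRepeat G t → HasRepeat G (Vec.map f t)
  HasRepeat-map f (rep e)  = rep (≡.cong f e)
  HasRepeat-map f (skip h) = skip (HasRepeat-map f h)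

  Admissible-cons : ∀ {n x y} {t : Vec (V G) n} → Near x y → Admissible (y ∷ t) → Admissible (x ∷ y ∷ t)
  Admissible-cons (inj₁ x≡y) _         = inj₂ (rep x≡y)
  Admissible-cons (inj₂ x~y) (inj₁ al) = inj₁ (cons x~y al)
  Admissible-cons (inj₂ x~y) (inj₂ hr) = inj₂ (skip hr)

  Allowed-map : ∀ {n} {f : V G → V G} → IsHom f → {t : Tuple G n} → Allowed G t → Admissible (Vec.map f t)
  Allowed-map hf one          = inj₁ one
  Allowed-map hf (cons x~y al) = Admissible-cons (hf x~y) (Allowed-map hf al)

  InC̃ : ∀ {n} → PathChain G n → Set (c ⊔ ℓ)
  InC̃ x = Σ[ z ∈ PathChain G _ ] (All (Allowed G ∘ proj₂) z × x ∼ z)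

  InTilde⇒InC̃ : ∀ {n} {x : PathChain G n} → InTilde G x → InC̃ x
  InTilde⇒InC̃ (z , al , e) = z , al , mk∼ e

  InC̃⇒InTilde : ∀ {n} {x : PathChain G n} → InC̃ x → InTilde G x
  InC̃⇒InTilde (z , al , e) = z , al , un∼ e

  InC̃-resp-∼ : ∀ {n} {x y : PathChain G n} → x ∼ y → InC̃ y → InC̃ x
  InC̃-resp-∼ e (z , al , e′) = z , al , ∼.trans e e′

  InC̃-[] : ∀ {n} → InC̃ {n} []
  InC̃-[] = [] , [] , ∼.refl

  InC̃-++ : ∀ {n} {x y : PathChain G n} → InC̃ x → InC̃ y → InC̃ (x ++ y)
  InC̃-++ (z , al , e) (z′ , al′ , e′) = z ++ z′ , Allₚ.++⁺ al al′ , ∼-++ e e′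

  InC̃-neg : ∀ {n} {x : PathChain G n} → InC̃ x → InC̃ (neg x)
  InC̃-neg (z , al , e) = neg z , Allₚ.map⁺ al , ∼-neg e

  Admissible⇒InC̃ : ∀ {n} {x : PathChain G n} → All (Admissible ∘ proj₂) x → InC̃ x
  Admissible⇒InC̃ []               = InC̃-[]
  Admissible⇒InC̃ (inj₁ al ∷ adm) with Admissible⇒InC̃ adm
  ... | z , al′ , e = _ ∷ z , al ∷ al′ , ∼-++ {xs = _ ∷ []} ∼.refl e
  Admissible⇒InC̃ (inj₂ hr ∷ adm) with Admissible⇒InC̃ adm
  ... | z , al′ , e = z , al′ , ∼-++ {xs = _ ∷ []} {xs′ = []} (Negligible⇒∼[] (hr ∷ [])) e

  push-resp-∼ : ∀ {n} (f : V G → V G) {x y : PathChain G n} → x ∼ y → push f x ∼ push f y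
  push-resp-∼ {n} f = Linear.additive-resp-∼ (tupleSetoid n) (tupleSetoid n) (HasRepeat G) (HasRepeat G) (push f)
    (Linear.relabel-resp-≃ (tupleSetoid n) (tupleSetoid n) (≡.cong (Vec.map f)))
    (relabel-additive _) (λ hr → Allₚ.map⁺ (All.map (HasRepeat-map f) hr))

  push-InC̃ : ∀ {n} {f : V G → V G} → IsHom f → {x : PathChain G n} → InC̃ x → InC̃ (push f x)
  push-InC̃ {f = f} hf (z , al , e) = InC̃-resp-∼ (push-resp-∼ f e) (Admissible⇒InC̃ (Allₚ.map⁺ (All.map (Allowed-map hf) al)))

  module Prism (f g : V G → V G) where

    -- (v₀ … vₙ) ↦ Σᵢ (−1)ⁱ (f v₀ … f vᵢ g vᵢ … g vₙ), written recursively
    prismTerm : ∀ {n} → Carrier → Tuple G n → PathChain G (suc n)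
    prismTerm r (a ∷ [])    = (r , f a ∷ g a ∷ []) ∷ []
    prismTerm r (a ∷ b ∷ w) = (r , f a ∷ g a ∷ Vec.map g (b ∷ w)) ∷ prepend (f a) (neg (prismTerm r (b ∷ w)))

    H : ∀ {n} → PathChain G n → PathChain G (suc n)
    H = bind prismTerm

    prismTerm-neg : ∀ {n} r (t : Tuple G n) → prismTerm (- r) t ≃ neg (prismTerm r t)
    prismTerm-neg r (a ∷ [])    = ≃.refl
    prismTerm-neg r (a ∷ b ∷ w) = ≃-++ {xs = _ ∷ []} ≃.refl
      (≃.trans (prepend-cong (f a) (≃-neg (prismTerm-neg r (b ∷ w)))) (≃.reflexive (relabel-neg (f a ∷_) _)))

    prismTerm-scale : ∀ {n} r (t : Tuple G n) → prismTerm r t ≃ scale r (prismTerm 1# t)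
    prismTerm-scale r (a ∷ [])    = Pointwise⇒≃ ((sym (*-identityʳ r) , ≡.refl) ∷ [])
    prismTerm-scale r (a ∷ b ∷ w) = ≃-++ (Pointwise⇒≃ ((sym (*-identityʳ r) , ≡.refl) ∷ []))
      (≃.trans (prepend-cong (f a) (≃.trans (≃-neg (prismTerm-scale r (b ∷ w))) (neg-scale r _)))
               (≃.reflexive (relabel-scale (f a ∷_) r _)))

    H-resp-≃ : ∀ {n} {xs ys : PathChain G n} → xs ≃ ys → H xs ≃ H ys
    H-resp-≃ {n} = Linear.bind-resp-≃ (tupleSetoid n) (tupleSetoid (suc n)) prismTerm-scale (λ { ≡.refl → ≃.refl })

    H-neg : ∀ {n} (xs : PathChain G n) → H (neg xs) ≃ neg (H xs)
    H-neg {n} = Linear.bind-neg (tupleSetoid n) (tupleSetoid (suc n)) prismTerm-neg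

    H-prepend : ∀ {k} a (zs : PathChain G k) →
                H (prepend a zs) ≃ prepend (f a) (prepend (g a) (push g zs)) ++ prepend (f a) (neg (H zs))
    H-prepend a []                        = ≃.refl
    H-prepend a ((s , u@(_ ∷ _)) ∷ zs) = ≃.trans (≃-++ {xs = prismTerm s (a ∷ u)} ≃.refl (H-prepend a zs))
      (≃.trans (++-interchange ((s , f a ∷ g a ∷ Vec.map g u) ∷ []) (prepend (f a) (neg (prismTerm s u)))
                               (prepend (f a) (prepend (g a) (push g zs))) (prepend (f a) (neg (H zs))))
               (≃.reflexive (≡.cong (prepend (f a) (prepend (g a) (push g ((s , u) ∷ zs))) ++_)
                                    (≡.sym (prepend-neg-++ (f a) (prismTerm s u) (H zs))))))

    ∂-prismTerm : ∀ {n} r (t : Tuple G (suc n)) →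
                  ∂Path G (prismTerm r t) ≃
                  ((r , Vec.map g t) ∷ []) ++ (neg ((r , Vec.map f t) ∷ []) ++ neg (H (∂Path G ((r , t) ∷ []))))
    ∂-prismTerm {zero} r (a ∷ b ∷ []) = rearrange
      ((var 0 ⊕ (⊝ var 1 ⊕ (⊝ ⊝ var 2 ⊕ ε))) ⊕ ((⊝ var 3 ⊕ (⊝ ⊝ var 1 ⊕ (⊝ ⊝ ⊝ var 4 ⊕ ε))) ⊕ ε))
      (var 0 ⊕ (⊝ var 4 ⊕ ⊝ (var 3 ⊕ (⊝ var 2 ⊕ ε)))) ρ _
      where
      ρ : ℕ → PathChain G 1
      ρ 0 = (r , g a ∷ g b ∷ []) ∷ []
      ρ 1 = (r , f a ∷ g b ∷ []) ∷ []
      ρ 2 = (r , f a ∷ g a ∷ []) ∷ []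
      ρ 3 = (r , f b ∷ g b ∷ []) ∷ []
      ρ _ = (r , f a ∷ f b ∷ []) ∷ []
    ∂-prismTerm {suc n} r t@(a ∷ w@(b ∷ _)) = begin
      ∂term r (f a ∷ g a ∷ Vec.map g w) ++ ∂Path G (prepend (f a) (neg (prismTerm r w)))
        ≈⟨ ≃-++ leading trailing ⟩
      ⟦ (var 0 ⊕ (⊝ var 1 ⊕ var 2)) ⊕ (⊝ var 3 ⊕ ⊝ ⊝ (var 1 ⊕ (⊝ var 4 ⊕ ⊝ var 5))) ⟧ᶜ X
        ≈⟨ rearrange ((var 0 ⊕ (⊝ var 1 ⊕ var 2)) ⊕ (⊝ var 3 ⊕ ⊝ ⊝ (var 1 ⊕ (⊝ var 4 ⊕ ⊝ var 5))))
                     (var 0 ⊕ (⊝ var 4 ⊕ ⊝ (var 3 ⊕ (⊝ var 2 ⊕ var 5)))) X _ ⟩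
      ⟦ var 0 ⊕ (⊝ var 4 ⊕ ⊝ (var 3 ⊕ (⊝ var 2 ⊕ var 5))) ⟧ᶜ X
        ≈⟨ ≃-++ {xs = X 0} ≃.refl (≃-++ {xs = neg (X 4)} ≃.refl (≃-neg prism-of-boundary)) ⟨
      X 0 ++ (neg (X 4) ++ neg (H (∂Path G ((r , t) ∷ [])))) ∎
      where
      open import Relation.Binary.Reasoning.Setoid (≃-setoid {suc (suc n)})
      Tg = ∂term r (Vec.map g w)
      B  = ∂term r w
      X : ℕ → PathChain G (suc (suc n))
      X 0 = (r , Vec.map g t) ∷ []
      X 1 = (r , f a ∷ Vec.map g w) ∷ []
      X 2 = prepend (f a) (prepend (g a) (∂Path G ((r , Vec.map g w) ∷ [])))
      X 3 = prismTerm r w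
      X 4 = (r , Vec.map f t) ∷ []
      X _ = prepend (f a) (H (∂Path G ((r , w) ∷ [])))

      prepend² : ∀ {xs ys : PathChain G n} → xs ≃ ys → prepend (f a) (prepend (g a) xs) ≃ prepend (f a) (prepend (g a) ys)
      prepend² = prepend-cong (f a) ∘ prepend-cong (g a)

      leading : ∂term r (f a ∷ g a ∷ Vec.map g w) ≃ ⟦ var 0 ⊕ (⊝ var 1 ⊕ var 2) ⟧ᶜ X
      leading = ≃.trans
        (≃.reflexive (≡.trans (∂term-cons r (f a) (g a ∷ Vec.map g w))
                              (≡.cong (λ z → (r , Vec.map g t) ∷ prepend (f a) (neg z)) (∂term-cons r (g a) (Vec.map g w)))))
        (≃-++ {xs = X 0} ≃.refl (≃-++ {xs = neg (X 1)} ≃.refl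
          (≃.trans (≃.reflexive (≡.cong (prepend (f a)) (≡.sym (relabel-neg (g a ∷_) (neg Tg)))))
                   (prepend² (≃.trans (neg-involutive Tg) (≃.reflexive (≡.sym (++-identityʳ Tg))))))))

      trailing : ∂Path G (prepend (f a) (neg (prismTerm r w))) ≃ ⟦ ⊝ var 3 ⊕ ⊝ ⊝ (var 1 ⊕ (⊝ var 4 ⊕ ⊝ var 5)) ⟧ᶜ X
      trailing = ≃.trans (∂Path-prepend (f a) (neg (prismTerm r w)))
        (≃-++ {xs = neg (X 3)} ≃.refl
          (≃.trans (prepend-cong (f a) (≃-neg (≃.trans (∂Path-neg (prismTerm r w)) (≃-neg (∂-prismTerm r w)))))
                   (≃.reflexive (relabel-⟦⟧ᶜ (f a ∷_) (⊝ ⊝ (var 0 ⊕ (⊝ var 1 ⊕ ⊝ var 2))) W))))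
        where
        W : ℕ → PathChain G (suc n)
        W 0 = (r , Vec.map g w) ∷ []
        W 1 = (r , Vec.map f w) ∷ []
        W _ = H (∂Path G ((r , w) ∷ []))

      prism-of-boundary : H (∂Path G ((r , t) ∷ [])) ≃ ⟦ var 3 ⊕ (⊝ var 2 ⊕ var 5) ⟧ᶜ X
      prism-of-boundary = ≃.trans
        (≃.reflexive (≡.cong H (≡.trans (++-identityʳ _) (∂term-cons r a w))))
        (≃-++ {xs = X 3} ≃.refl (≃.trans (H-prepend a (neg B)) (≃-++ first second)))
        where
        first : prepend (f a) (prepend (g a) (push g (neg B))) ≃ neg (X 2)
        first = ≃.trans (prepend² (≃.reflexive (≡.trans (relabel-neg (Vec.map g) B) (≡.cong neg (push-∂term g r w)))))
                (≃.trans (prepend² (≃-neg (≃.reflexive (≡.sym (++-identityʳ Tg)))))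
                         (≃.reflexive (≡.trans (≡.cong (prepend (f a)) (relabel-neg (g a ∷_) _)) (relabel-neg (f a ∷_) _))))
        second : prepend (f a) (neg (H (neg B))) ≃ X 5
        second = prepend-cong (f a) (≃.trans (≃-neg (H-neg B))
                   (≃.trans (neg-involutive (H B)) (≃.reflexive (≡.cong H (≡.sym (++-identityʳ B))))))

    chain-prism : ∀ {m} (xs : PathChain G (suc m)) → ∂Path G (H xs) ≃ push g xs ++ (neg (push f xs) ++ neg (H (∂Path G xs)))
    chain-prism {m} = additive-ext (∂Path G ∘ H) (λ xs → push g xs ++ (neg (push f xs) ++ neg (H (∂Path G xs))))
      (additive⇒additive≃ (∘-additive {L = ∂Path G} {K = H} (bind-additive ∂term) (bind-additive prismTerm)))
      (homotopy-formula-additive (push g) (push f) (H ∘ ∂Path G) (relabel-additive _) (relabel-additive _)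
                                 (∘-additive {L = H} {K = ∂Path G} (bind-additive prismTerm) (bind-additive ∂term)))
      ≃.refl
      (λ r t → ≃.trans (≃.reflexive (≡.cong (∂Path G) (++-identityʳ (prismTerm r t)))) (∂-prismTerm r t))

    prismTerm-head : ∀ {n} r (t : Tuple G n) → All (λ p → Vec.head (proj₂ p) ≡ f (Vec.head t)) (prismTerm r t)
    prismTerm-head r (a ∷ [])    = ≡.refl ∷ []
    prismTerm-head r (a ∷ b ∷ w) = ≡.refl ∷ Allₚ.map⁺ (Allₚ.map⁺ (All.map (λ _ → ≡.refl) (prismTerm-head r (b ∷ w))))

    prismTerm-HasRepeat : ∀ {n} r {t : Tuple G n} → HasRepeat G t → All (HasRepeat G ∘ proj₂) (prismTerm r t)
    prismTerm-HasRepeat r {a ∷ b ∷ w} (rep a≡b) = skip (rep (≡.cong g a≡b))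
      ∷ Allₚ.map⁺ (Allₚ.map⁺ (All.map starts-with-f-b (prismTerm-head r (b ∷ w))))
      where
      starts-with-f-b : ∀ {u : Tuple G _} → Vec.head u ≡ f b → HasRepeat G (f a ∷ u)
      starts-with-f-b {x ∷ u} x≡fb = rep (≡.trans (≡.cong f a≡b) (≡.sym x≡fb))
    prismTerm-HasRepeat r {a ∷ b ∷ w} (skip hr) = skip (skip (HasRepeat-map g hr))
      ∷ Allₚ.map⁺ (Allₚ.map⁺ (All.map skip (prismTerm-HasRepeat r hr)))

    H-resp-∼ : ∀ {n} {x y : PathChain G n} → x ∼ y → H x ∼ H y
    H-resp-∼ {n} = Linear.additive-resp-∼ (tupleSetoid n) (tupleSetoid (suc n)) (HasRepeat G) (HasRepeat G) H
      H-resp-≃ (bind-additive prismTerm) negligible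
      where
      negligible : ∀ {z : PathChain G n} → Negligible z → Negligible (H z)
      negligible []        = []
      negligible (hr ∷ hs) = Allₚ.++⁺ (prismTerm-HasRepeat _ hr) (negligible hs)

  module PrismAdmissible (f g : V G → V G) (hf : IsHom f) (hg : IsHom g) (f~g : OneStep f g) where
    open Prism f g

    prismTerm-Admissible : ∀ {n} r {t : Tuple G n} → Allowed G t → All (Admissible ∘ proj₂) (prismTerm r t)
    prismTerm-Admissible r {a ∷ []}    one             = Admissible-cons (f~g a) (inj₁ one) ∷ []
    prismTerm-Admissible r {a ∷ b ∷ w} (cons a~b al) = Admissible-cons (f~g a) (Allowed-map hg (cons a~b al))
      ∷ Allₚ.map⁺ (Allₚ.map⁺ (All.zipWith extend (prismTerm-Admissible r al , prismTerm-head r (b ∷ w))))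
      where
      extend : ∀ {u : Tuple G _} → Admissible u × Vec.head u ≡ f b → Admissible (f a ∷ u)
      extend {x ∷ u} (adm , ≡.refl) = Admissible-cons (hf a~b) adm

    H-InC̃ : ∀ {n} {x : PathChain G n} → InC̃ x → InC̃ (H x)
    H-InC̃ {n} (z , al , e) = InC̃-resp-∼ (H-resp-∼ e) (Admissible⇒InC̃ (admissible al))
      where
      admissible : ∀ {z : PathChain G n} → All (Allowed G ∘ proj₂) z → All (Admissible ∘ proj₂) (H z)
      admissible []        = []
      admissible (a ∷ als) = Allₚ.++⁺ (prismTerm-Admissible _ a) (admissible als)

  InducesZero : (V G → V G) → ℕ → Set (c ⊔ ℓ)
  InducesZero f m = ∀ (x : PathChain G (suc m)) → InΩ G x → ∂Path G x ∼ [] →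
                    Σ[ y ∈ PathChain G (suc (suc m)) ] (InΩ G y × ∂Path G y ∼ push f x)

  constant-induces-zero : ∀ {f} → (∀ u v → f u ≡ f v) → ∀ m → InducesZero f m
  constant-induces-zero {f} f-const m x _ _ =
    [] , (InC̃⇒InTilde InC̃-[] , InC̃⇒InTilde InC̃-[]) , ∼.sym (Negligible⇒∼[] (negligible x))
    where
    negligible : ∀ (x : PathChain G (suc m)) → Negligible (push f x)
    negligible []                     = []
    negligible ((_ , a ∷ b ∷ _) ∷ x) = rep (f-const a b) ∷ negligible x

  step-induces-zero : ∀ {f g} (hf : IsHom f) (hg : IsHom g) → OneStep f g → ∀ m → InducesZero g m → InducesZero f m
  step-induces-zero {f} {g} hf hg f~g m g-zero x x∈Ω@(x∈C̃ , ∂x∈C̃) ∂x∼0 with g-zero x x∈Ω ∂x∼0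
  ... | y , (y∈C̃ , ∂y∈C̃) , ∂y∼gx =
    y ++ neg (H x) , (InC̃⇒InTilde y′∈C̃ , InC̃⇒InTilde ∂y′∈C̃) ,
    ∼.trans (≃⇒∼ ∂y′≃) (homotopy-step ∂y∼gx (chain-prism x) (H-resp-∼ ∂x∼0))
    where
    open Prism f g
    open PrismAdmissible f g hf hg f~g
    ∂y′≃ : ∂Path G (y ++ neg (H x)) ≃ ∂Path G y ++ neg (∂Path G (H x))
    ∂y′≃ = ≃.trans (≃.reflexive (bind-additive ∂term y (neg (H x)))) (≃-++ ≃.refl (∂Path-neg (H x)))
    x∈C̃′ = InTilde⇒InC̃ {x = x} x∈C̃
    y′∈C̃ : InC̃ (y ++ neg (H x))
    y′∈C̃ = InC̃-++ (InTilde⇒InC̃ {x = y} y∈C̃) (InC̃-neg (H-InC̃ x∈C̃′))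
    ∂y′∈C̃ : InC̃ (∂Path G (y ++ neg (H x)))
    ∂y′∈C̃ = InC̃-resp-∼ (≃⇒∼ (≃.trans ∂y′≃ (≃-++ ≃.refl (≃-neg (chain-prism x)))))
      (InC̃-++ (InTilde⇒InC̃ {x = ∂Path G y} ∂y∈C̃)
        (InC̃-neg (InC̃-++ (push-InC̃ hg x∈C̃′)
          (InC̃-++ (InC̃-neg (push-InC̃ hf x∈C̃′)) (InC̃-neg (H-InC̃ (InTilde⇒InC̃ {x = ∂Path G x} ∂x∈C̃)))))))

  homotopic-to-constant-induces-zero : ∀ {f} → HomotopicToConstant f → ∀ m → InducesZero f m
  homotopic-to-constant-induces-zero (constant _ f-const) = constant-induces-zero f-const
  homotopic-to-constant-induces-zero (via hf f~g h) m =
    step-induces-zero hf (HomotopicToConstant⇒IsHom h) f~g m (homotopic-to-constant-induces-zero h m)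

  path-homology-vanishes : Contractible → ∀ m → PathHomologyVanishesAt G (suc m)
  path-homology-vanishes h m x x∈Ω ∂x≈0 with homotopic-to-constant-induces-zero h m x x∈Ω (mk∼ ∂x≈0)
  ... | y , y∈Ω , ∂y∼x = y , y∈Ω , un∼ (∼.trans ∂y∼x (≃⇒∼ (≃.reflexive (push-id x))))

module Contraction (G : Graph) where

  open Homotopy G

  sequence-homotopic : (F : ℕ → V G → V G) → (∀ k → IsHom (F k)) → (∀ k → OneStep (F k) (F (suc k))) →
                       ∀ N → (∀ u v → F N u ≡ F N v) → HomotopicToConstant (F 0)
  sequence-homotopic F hom one-step N const = from N 0 (ℕₚ.+-identityʳ N)
    where
    from : ∀ r k → r ℕ.+ k ≡ N → HomotopicToConstant (F k)
    from zero    k ≡.refl = constant (hom k) const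
    from (suc r) k r+k≡N  = via (hom k) (one-step k) (from r (suc k) (≡.trans (ℕₚ.+-suc r k) r+k≡N))

  contractible-if-pointed : (V G → Contractible) → Contractible
  contractible-if-pointed from-vertex with vertices G in e
  ... | []    = constant IsHom-id (λ u → ⊥-elim (no-vertex u))
    where
    no-vertex : V G → ⊥
    no-vertex u with () ← ≡.subst (u ∈_) e (complete G u)
  ... | v ∷ _ = from-vertex v

complete-contractible : (G : Graph) → IsComplete G → Homotopy.Contractible G
complete-contractible G complete-G = contractible-if-pointed λ v₀ →
  via IsHom-id (to-v₀ v₀) (constant (λ _ → inj₁ ≡.refl) (λ _ _ → ≡.refl))
  where
  open Homotopy G
  open Contraction G
  to-v₀ : ∀ v₀ → OneStep id (λ _ → v₀)
  to-v₀ v₀ v with _≟V_ G v v₀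
  ... | yes v≡v₀ = inj₁ v≡v₀
  ... | no  v≢v₀ = inj₂ (complete-G v v₀ v≢v₀)

module HypercubeContraction (d : ℕ) where

  open Homotopy (Q d)

  clear : ∀ {n} → ℕ → Vec Bool n → Vec Bool n
  clear zero    a       = a
  clear (suc k) []      = []
  clear (suc k) (b ∷ a) = false ∷ clear k a

  clear-hom : ∀ {n} k {a b : Vec Bool n} → QAdj a b → clear k a ≡ clear k b ⊎ QAdj (clear k a) (clear k b)
  clear-hom zero    a~b       = inj₂ a~b
  clear-hom (suc k) (here _)  = inj₁ ≡.refl
  clear-hom (suc k) (there a~b) with clear-hom k a~b
  ... | inj₁ e = inj₁ (≡.cong (false ∷_) e)
  ... | inj₂ q = inj₂ (there q)

  clear-step : ∀ {n} k (a : Vec Bool n) → clear k a ≡ clear (suc k) a ⊎ QAdj (clear k a) (clear (suc k) a)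
  clear-step zero    []          = inj₁ ≡.refl
  clear-step zero    (false ∷ a) = inj₁ ≡.refl
  clear-step zero    (true ∷ a)  = inj₂ (here λ ())
  clear-step (suc k) []          = inj₁ ≡.refl
  clear-step (suc k) (b ∷ a) with clear-step k a
  ... | inj₁ e = inj₁ (≡.cong (false ∷_) e)
  ... | inj₂ q = inj₂ (there q)

  clear-all : ∀ {n} k (a b : Vec Bool n) → clear (k ℕ.+ n) a ≡ clear (k ℕ.+ n) b
  clear-all {zero}  k []      []      = ≡.refl
  clear-all {suc n} k (x ∷ a) (y ∷ b) rewrite ℕₚ.+-suc k n = ≡.cong (false ∷_) (clear-all k a b)

  contractible : Contractible
  contractible = sequence-homotopic (λ k → clear k) clear-hom clear-step d (clear-all 0)
    where open Contraction (Q d)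

module Routes (G : Graph) where

  data Route : V G → V G → List (V G) → Set where
    end : ∀ {a} → Route a a (a ∷ [])
    hop : ∀ {a b c l} → Adj G a b → Route b c l → Route a c (a ∷ l)

  data Distinct : List (V G) → Set where
    []  : Distinct []
    _∷_ : ∀ {x l} → x ∉ l → Distinct l → Distinct (x ∷ l)

  reverse : List (V G) → List (V G)
  reverse []      = []
  reverse (x ∷ l) = reverse l ++ (x ∷ [])

  tail : List (V G) → List (V G)
  tail []      = []
  tail (x ∷ l) = l

  Route-snoc : ∀ {a b c l} → Route a b l → Adj G b c → Route a c (l ++ (c ∷ []))
  Route-snoc end       b~c = hop b~c end
  Route-snoc (hop e p) b~c = hop e (Route-snoc p b~c)

  Route-reverse : ∀ {a b l} → Route a b l → Route b a (reverse l)
  Route-reverse end       = end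
  Route-reverse (hop e p) = Route-snoc (Route-reverse p) (Adj-sym G e)

  Route-join : ∀ {a b c l l′} → Route a b l → Route b c l′ → Route a c (l ++ tail l′)
  Route-join end       end       = end
  Route-join end       (hop e p) = hop e p
  Route-join (hop e p) q         = hop e (Route-join p q)

  Route-prefix : ∀ {a c z} p {s} → Route a c (p ++ z ∷ s) → Route a z (p ++ z ∷ [])
  Route-prefix []          end       = end
  Route-prefix []          (hop e q) = end
  Route-prefix (x ∷ [])    (hop e q) = hop e (Route-prefix [] q)
  Route-prefix (x ∷ y ∷ p) (hop e q) = hop e (Route-prefix (y ∷ p) q)

  Route-head : ∀ {a b l} → Route a b l → l ≡ a ∷ tail l
  Route-head end       = ≡.refl
  Route-head (hop e p) = ≡.refl

  Route-end∈ : ∀ {a b l} → Route a b l → b ∈ l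
  Route-end∈ end       = here ≡.refl
  Route-end∈ (hop e p) = there (Route-end∈ p)

  Route-single : ∀ {a b c} → Route a b (c ∷ []) → a ≡ b
  Route-single end = ≡.refl

  Route-lookup-adj : ∀ {a b x l} → Route a b (x ∷ l) → ∀ (i : Fin (length l)) →
                     Adj G (lookup (x ∷ l) (inject₁ i)) (lookup (x ∷ l) (suc i))
  Route-lookup-adj (hop e end)         zero    = e
  Route-lookup-adj (hop e (hop e′ p))  zero    = e
  Route-lookup-adj (hop e p@(hop _ _)) (suc i) = Route-lookup-adj p i

  Route-lookup-last : ∀ {a b x l} → Route a b (x ∷ l) → lookup (x ∷ l) (fromℕ (length l)) ≡ b
  Route-lookup-last end                 = ≡.refl
  Route-lookup-last (hop e end)         = ≡.refl
  Route-lookup-last (hop e p@(hop _ _)) = Route-lookup-last p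

  ∈-reverse : ∀ {x} l → x ∈ reverse l → x ∈ l
  ∈-reverse (y ∷ l) m with ∈-++⁻ (reverse l) m
  ... | inj₁ m′        = there (∈-reverse l m′)
  ... | inj₂ (here e) = here e

  ∈-tail : ∀ {x} l → x ∈ tail l → x ∈ l
  ∈-tail (y ∷ l) m = there m

  Distinct-++ : ∀ {a b} → Distinct a → Distinct b → (∀ {x} → x ∈ a → x ∉ b) → Distinct (a ++ b)
  Distinct-++ [] db disjoint = db
  Distinct-++ {x ∷ a} (x∉a ∷ da) db disjoint = x∉a++b ∷ Distinct-++ da db (disjoint ∘′ there)
    where
    x∉a++b : x ∉ a ++ _
    x∉a++b m with ∈-++⁻ a m
    ... | inj₁ m′ = x∉a m′
    ... | inj₂ m′ = disjoint (here ≡.refl) m′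

  Distinct-reverse : ∀ {l} → Distinct l → Distinct (reverse l)
  Distinct-reverse [] = []
  Distinct-reverse {x ∷ l} (x∉l ∷ d) =
    Distinct-++ (Distinct-reverse d) ((λ ()) ∷ []) (λ { m (here ≡.refl) → x∉l (∈-reverse l m) })

  Distinct-prefix : ∀ p {z s} → Distinct (p ++ z ∷ s) → Distinct (p ++ z ∷ [])
  Distinct-prefix []      (_ ∷ _)     = (λ ()) ∷ []
  Distinct-prefix (x ∷ p) {z} {s} (x∉ ∷ d) = (λ m → x∉ (widen m)) ∷ Distinct-prefix p d
    where
    widen : ∀ {y} → y ∈ p ++ z ∷ [] → y ∈ p ++ z ∷ s
    widen m with ∈-++⁻ p m
    ... | inj₁ m′        = ∈-++⁺ˡ m′
    ... | inj₂ (here e) = ∈-++⁺ʳ p (here e)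

  Distinct-tail : ∀ {l} → Distinct l → Distinct (tail l)
  Distinct-tail []      = []
  Distinct-tail (_ ∷ d) = d

  lookup-injective : ∀ {l} → Distinct l → ∀ i j → lookup l i ≡ lookup l j → i ≡ j
  lookup-injective (x∉ ∷ d) zero    zero    e = ≡.refl
  lookup-injective {x ∷ l} (x∉ ∷ d) zero    (suc j) e = contradiction (≡.subst (_∈ l) (≡.sym e) (∈-lookup j)) x∉
  lookup-injective {x ∷ l} (x∉ ∷ d) (suc i) zero    e = contradiction (≡.subst (_∈ l) e (∈-lookup i)) x∉
  lookup-injective (x∉ ∷ d) (suc i) (suc j) e = ≡.cong suc (lookup-injective d i j e)

module Acyclicity (G : Graph) (acyclic : Acyclic G) where

  open Routes G
  open import Data.List.Membership.DecPropositional (_≟V_ G) using (_∈?_)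

  -- a distinct route a … b with at least three vertices, closed by an edge b a, is a cycle
  closed-route-absurd : ∀ {a b} (l : List (V G)) → Route a b (a ∷ l) → Adj G b a → Distinct (a ∷ l) →
                        (∀ w → l ≢ w ∷ []) → ⊥
  closed-route-absurd []               end b~a _ _      = Adj-irr G b~a
  closed-route-absurd (w ∷ [])         _   _   _ not-2 = not-2 w ≡.refl
  closed-route-absurd {a} (w ∷ w′ ∷ l) p   b~a d _     = acyclic record
    { len   = length l
    ; vs    = lookup (a ∷ w ∷ w′ ∷ l)
    ; inj   = lookup-injective d
    ; adj   = Route-lookup-adj p
    ; close = ≡.subst (λ z → Adj G z a) (≡.sym (Route-lookup-last p)) b~a
    }

  first-common : ∀ (l₁ l₂ : List (V G)) → Σ[ x ∈ V G ] (x ∈ l₁ × x ∈ l₂) →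
                 Σ[ p ∈ List (V G) ] Σ[ z ∈ V G ] Σ[ s ∈ List (V G) ]
                   (l₁ ≡ p ++ z ∷ s × z ∈ l₂ × (∀ {x} → x ∈ p → x ∉ l₂))
  first-common (a ∷ t) l₂ (x , x∈ , x∈l₂) with a ∈? l₂
  ... | yes a∈l₂ = [] , a , t , ≡.refl , a∈l₂ , λ ()
  ... | no a∉l₂ with x∈
  ...   | here x≡a = contradiction (≡.subst (_∈ l₂) x≡a x∈l₂) a∉l₂
  ...   | there x∈t with first-common t l₂ (x , x∈t , x∈l₂)
  ...     | p , z , s , e , z∈ , disjoint = a ∷ p , z , s , ≡.cong (a ∷_) e , z∈ ,
            λ { (here y≡a) → λ y∈ → a∉l₂ (≡.subst (_∈ l₂) y≡a y∈) ; (there y∈p) → disjoint y∈p }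

  split-at-first : ∀ {z} (l : List (V G)) → z ∈ l → Σ[ q ∈ List (V G) ] Σ[ s ∈ List (V G) ] (l ≡ q ++ z ∷ s × z ∉ q)
  split-at-first {z} (b ∷ t) z∈ with _≟V_ G b z
  ... | yes b≡z = [] , t , ≡.cong (_∷ t) b≡z , λ ()
  ... | no b≢z with z∈
  ...   | here z≡b = contradiction (≡.sym z≡b) b≢z
  ...   | there z∈t with split-at-first t z∈t
  ...     | q , s , e , z∉q = b ∷ q , s , ≡.cong (b ∷_) e , λ { (here z≡b) → b≢z (≡.sym z≡b) ; (there m) → z∉q m }

  -- two distinct routes to r leaving u through different neighbours close up into a cycle
  no-two-branches : ∀ {u x y r l₁ l₂} → Adj G u x → Route x r l₁ → Distinct l₁ → u ∉ l₁ →
                    Adj G u y → Route y r l₂ → Distinct l₂ → u ∉ l₂ → x ≢ y → ⊥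
  no-two-branches {u} {x} {y} {r} {l₁} {l₂} u~x route₁ d₁ u∉l₁ u~y route₂ d₂ u∉l₂ x≢y =
    closed-route-absurd c (hop u~x route-c) (Adj-sym G u~y) (u∉c ∷ distinct-c) not-two
    where
    common = first-common l₁ l₂ (r , Route-end∈ route₁ , Route-end∈ route₂)
    p = proj₁ common
    z = proj₁ (proj₂ common)
    l₁≡ : l₁ ≡ p ++ z ∷ proj₁ (proj₂ (proj₂ common))
    l₁≡ = proj₁ (proj₂ (proj₂ (proj₂ common)))
    p∩l₂ : ∀ {w} → w ∈ p → w ∉ l₂
    p∩l₂ = proj₂ (proj₂ (proj₂ (proj₂ (proj₂ common))))
    split = split-at-first l₂ (proj₁ (proj₂ (proj₂ (proj₂ (proj₂ common)))))
    q = proj₁ split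
    l₂≡ : l₂ ≡ q ++ z ∷ proj₁ (proj₂ split)
    l₂≡ = proj₁ (proj₂ (proj₂ split))

    A = p ++ z ∷ []
    R = reverse (q ++ z ∷ [])
    c = A ++ tail R

    route-R : Route z y R
    route-R = Route-reverse (Route-prefix q (≡.subst (Route y r) l₂≡ route₂))
    route-c : Route x y c
    route-c = Route-join (Route-prefix p (≡.subst (Route x r) l₁≡ route₁)) route-R

    A⊆l₁ : ∀ {w} → w ∈ A → w ∈ l₁
    A⊆l₁ m with ∈-++⁻ p m
    ... | inj₁ m′        = ≡.subst (_ ∈_) (≡.sym l₁≡) (∈-++⁺ˡ m′)
    ... | inj₂ (here e) = ≡.subst (_ ∈_) (≡.sym l₁≡) (∈-++⁺ʳ p (here e))
    tailR⊆l₂ : ∀ {w} → w ∈ tail R → w ∈ l₂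
    tailR⊆l₂ m with ∈-++⁻ q (∈-reverse (q ++ z ∷ []) (∈-tail R m))
    ... | inj₁ m′        = ≡.subst (_ ∈_) (≡.sym l₂≡) (∈-++⁺ˡ m′)
    ... | inj₂ (here e) = ≡.subst (_ ∈_) (≡.sym l₂≡) (∈-++⁺ʳ q (here e))

    distinct-R : Distinct (z ∷ tail R)
    distinct-R = ≡.subst Distinct (Route-head route-R) (Distinct-reverse (Distinct-prefix q (≡.subst Distinct l₂≡ d₂)))
    z∉tailR : z ∉ tail R
    z∉tailR with distinct-R
    ... | z∉ ∷ _ = z∉
    distinct-c : Distinct c
    distinct-c = Distinct-++ (Distinct-prefix p (≡.subst Distinct l₁≡ d₁)) (Distinct-tail distinct-R) disjoint
      where
      disjoint : ∀ {w} → w ∈ A → w ∉ tail R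
      disjoint m with ∈-++⁻ p m
      ... | inj₁ m′            = λ m″ → p∩l₂ m′ (tailR⊆l₂ m″)
      ... | inj₂ (here ≡.refl) = z∉tailR
    u∉c : u ∉ c
    u∉c m with ∈-++⁻ A m
    ... | inj₁ m′ = u∉l₁ (A⊆l₁ m′)
    ... | inj₂ m′ = u∉l₂ (tailR⊆l₂ m′)

    -- c = [w] would force p = [] and R = [z], i.e. x = z = y
    not-two : ∀ w → c ≢ w ∷ []
    not-two w c≡[w] with p | l₁≡
    ... | _ ∷ p′ | _    = lemma p′ c≡[w]
      where
      lemma : ∀ p′ {v} → (v ∷ p′ ++ z ∷ []) ++ tail R ≢ w ∷ []
      lemma [] ()
      lemma (_ ∷ _) ()
    ... | []     | l₁≡′ = x≢y (≡.trans x≡z z≡y)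
      where
      x≡z : x ≡ z
      x≡z = ∷-injectiveˡ (≡.trans (≡.sym (Route-head route₁)) l₁≡′)
      z≡y : z ≡ y
      z≡y = Route-single (≡.subst (Route z y) (≡.trans (Route-head route-R) (≡.cong (z ∷_) (≡.cong tail c≡[w]))) route-R)

  simple-route-unique : ∀ {u r l l′} → Route u r l → Distinct l → Route u r l′ → Distinct l′ → l ≡ l′
  simple-route-unique end d end d′ = ≡.refl
  simple-route-unique end d (hop e p′) (u∉ ∷ d′) = contradiction (Route-end∈ p′) u∉
  simple-route-unique (hop e p) (u∉ ∷ d) end d′ = contradiction (Route-end∈ p) u∉
  simple-route-unique {u} (hop {b = x} u~x p) (u∉ ∷ d) (hop {b = y} u~y p′) (u∉′ ∷ d′) with _≟V_ G x y
  ... | yes ≡.refl = ≡.cong (u ∷_) (simple-route-unique p d p′ d′)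
  ... | no x≢y     = ⊥-elim (no-two-branches u~x p d u∉ u~y p′ d′ u∉′ x≢y)

  suffix-from : ∀ {x r l} u → Route x r l → Distinct l → u ∈ l →
                Σ[ l′ ∈ List (V G) ] (Route u r l′ × Distinct l′ × (∀ {z} → z ∈ l′ → z ∈ l))
  suffix-from u end d (here ≡.refl) = _ , end , d , id
  suffix-from {x} u (hop e p) (x∉ ∷ d) m with _≟V_ G u x
  ... | yes ≡.refl = _ , hop e p , x∉ ∷ d , id
  ... | no u≢x with m
  ...   | here u≡x = contradiction u≡x u≢x
  ...   | there m′ with suffix-from u p d m′
  ...     | l′ , p′ , d′ , sub = l′ , p′ , d′ , there ∘′ sub

module TreeContraction (G : Graph) (connected : Connected G) (acyclic : Acyclic G) (ρ : V G) where

  open Routes G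
  open Acyclicity G acyclic
  open Homotopy G
  open import Data.List.Membership.DecPropositional (_≟V_ G) using (_∈?_)

  simple-route : ∀ u → Walk G u ρ → Σ[ l ∈ List (V G) ] (Route u ρ l × Distinct l)
  simple-route u (stop .u) = u ∷ [] , end , (λ ()) ∷ []
  simple-route u (step u~w walk) with simple-route _ walk
  ... | l , p , d with u ∈? l
  ...   | yes u∈l = let (l′ , p′ , d′ , _) = suffix-from u p d u∈l in l′ , p′ , d′
  ...   | no u∉l  = u ∷ l , hop u~w p , u∉l ∷ d

  route : V G → List (V G)
  route v = proj₁ (simple-route v (connected v ρ))

  route-valid : ∀ v → Route v ρ (route v)
  route-valid v = proj₁ (proj₂ (simple-route v (connected v ρ)))

  route-distinct : ∀ v → Distinct (route v)
  route-distinct v = proj₂ (proj₂ (simple-route v (connected v ρ)))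

  edge-routes : ∀ {u w} → Adj G u w → route u ≡ u ∷ route w ⊎ route w ≡ w ∷ route u
  edge-routes {u} {w} u~w with u ∈? route w
  ... | no u∉ = inj₁ (simple-route-unique (route-valid u) (route-distinct u) (hop u~w (route-valid w)) (u∉ ∷ route-distinct w))
  ... | yes u∈ with w ∈? route u
  ...   | no w∉ = inj₂ (simple-route-unique (route-valid w) (route-distinct w)
                                           (hop (Adj-sym G u~w) (route-valid u)) (w∉ ∷ route-distinct u))
  ...   | yes w∈ = ⊥-elim (absurd (route-valid w) (route-distinct w) u∈)
    where
    absurd : ∀ {l} → Route w ρ l → Distinct l → u ∈ l → ⊥
    absurd end       _         (here ≡.refl) = Adj-irr G u~w
    absurd (hop e p) _         (here ≡.refl) = Adj-irr G u~w
    absurd (hop e p) (w∉ ∷ d) (there u∈′) with suffix-from u p d u∈′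
    ... | l′ , p′ , d′ , sub =
      w∉ (sub (≡.subst (w ∈_) (simple-route-unique (route-valid u) (route-distinct u) p′ d′) w∈))

  -- the vertex k steps along the list, stopping at its last vertex (ρ for the empty list)
  advance : ℕ → List (V G) → V G
  advance _       []          = ρ
  advance zero    (x ∷ _)     = x
  advance (suc k) (x ∷ [])    = x
  advance (suc k) (x ∷ y ∷ l) = advance k (y ∷ l)

  advance-step : ∀ {w l} → Route w ρ l → ∀ k → Near (advance k l) (advance (suc k) l)
  advance-step end                 zero    = inj₁ ≡.refl
  advance-step end                 (suc k) = inj₁ ≡.refl
  advance-step (hop e end)         zero    = inj₂ e
  advance-step (hop e (hop _ _))   zero    = inj₂ e
  advance-step (hop e p@end)       (suc k) = advance-step p k
  advance-step (hop e p@(hop _ _)) (suc k) = advance-step p k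

  advance-zero : ∀ {w l} → Route w ρ l → advance zero l ≡ w
  advance-zero end       = ≡.refl
  advance-zero (hop e p) = ≡.refl

  advance-cons : ∀ {w l} → Route w ρ l → ∀ u k → advance (suc k) (u ∷ l) ≡ advance k l
  advance-cons end       u k = ≡.refl
  advance-cons (hop e p) u k = ≡.refl

  advance-end : ∀ {w l} → Route w ρ l → ∀ k → length l ≤ suc k → advance k l ≡ ρ
  advance-end end                 zero    _         = ≡.refl
  advance-end end                 (suc k) _         = ≡.refl
  advance-end (hop e end)         (suc k) (s≤s l≤) = advance-end end k l≤
  advance-end (hop e p@(hop _ _)) (suc k) (s≤s l≤) = advance-end p k l≤

  towards-root : ℕ → V G → V G
  towards-root k v = advance k (route v)

  towards-root-along-edge : ∀ {u w} k → Adj G u w → route u ≡ u ∷ route w → Near (towards-root k u) (towards-root k w)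
  towards-root-along-edge {u} {w} zero u~w _ =
    inj₂ (≡.subst₂ (Adj G) (≡.sym (advance-zero (route-valid u))) (≡.sym (advance-zero (route-valid w))) u~w)
  towards-root-along-edge {u} {w} (suc k) _ e rewrite e | advance-cons (route-valid w) u k = advance-step (route-valid w) k

  towards-root-hom : ∀ k → IsHom (towards-root k)
  towards-root-hom k u~w with edge-routes u~w
  ... | inj₁ e = towards-root-along-edge k u~w e
  ... | inj₂ e = Near-sym (towards-root-along-edge k (Adj-sym G u~w) e)

  longest-route : List (V G) → ℕ
  longest-route []       = 0
  longest-route (v ∷ vs) = length (route v) ℕ.⊔ longest-route vs

  route-length-bounded : ∀ {v} vs → v ∈ vs → length (route v) ≤ longest-route vs
  route-length-bounded (x ∷ vs) (here ≡.refl) = ℕₚ.m≤m⊔n _ _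
  route-length-bounded (x ∷ vs) (there m)     = ≤-trans (route-length-bounded vs m) (ℕₚ.m≤n⊔m _ _)

  depth-bound : ℕ
  depth-bound = longest-route (vertices G)

  contractible : Contractible
  contractible = via IsHom-id (λ v → inj₁ (≡.sym (advance-zero (route-valid v))))
    (sequence-homotopic towards-root towards-root-hom (λ k v → advance-step (route-valid v) k) depth-bound
      (λ u v → ≡.trans (at-root u) (≡.sym (at-root v))))
    where
    open Contraction G
    at-root : ∀ v → towards-root depth-bound v ≡ ρ
    at-root v = advance-end (route-valid v) depth-bound (≤-trans (route-length-bounded (vertices G) (complete G v)) (ℕₚ.n≤1+n _))

tree-contractible : (G : Graph) → IsTree G → Homotopy.Contractible G
tree-contractible G (connected , acyclic) = Contraction.contractible-if-pointed G (TreeContraction.contractible G connected acyclic)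

corollary4p3 : ∀ {c ℓ} (R : CommutativeRing c ℓ) →
    ((G : Graph) → IsTree G ⊎ IsComplete G → ∀ (n : ℕ) → 0 < n →
      Chains.CubeHomologyVanishesAt R G n × Chains.PathHomologyVanishesAt R G n)
    × ((d : ℕ) → ∀ (n : ℕ) → 0 < n →
      Chains.CubeHomologyVanishesAt R (Q d) n × Chains.PathHomologyVanishesAt R (Q d) n)
corollary4p3 R = (λ G tree-or-complete → vanishes G (contractible G tree-or-complete))
               , (λ d → vanishes (Q d) (HypercubeContraction.contractible d))
  where
  vanishes : (G : Graph) → Homotopy.Contractible G → ∀ n → 0 < n →
             Chains.CubeHomologyVanishesAt R G n × Chains.PathHomologyVanishesAt R G n
  vanishes G h (suc m) _ = CubicalVanishing.cubical-homology-vanishes R G h m , PathVanishing.path-homology-vanishes R G h m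
  contractible : (G : Graph) → IsTree G ⊎ IsComplete G → Homotopy.Contractible G
  contractible G (inj₁ tree)     = tree-contractible G tree
  contractible G (inj₂ complete) = complete-contractible G complete
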